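{- A pentagonal tiling of a compact connected surface without boundary is the simple pentagonal subdivision of some quadrilateral tiling if and only if it is possible to label some of its vertices by $\bullet$ such that every unlabelled vertex has degree $3$ and every tile is of one of the types $P_1$, $P_2$, $P_3$.
   Context: A tiling of a compact connected surface without boundary is a graph embedded in the surface such that the complementary regions (tiles) are open disks; tilings are edge-to-edge, every vertex has degree at least $3$, every tile has at least $3$ edges, and tiles may be degenerate (boundary not a simple closed curve). A pentagonal (resp. quadrilateral) tiling has $5$ (resp. $4$) edges along each tile boundary. A simple pentagonal subdivision of a quadrilateral tiling is the pentagonal tiling obtained by placing a new vertex at the middle point of every edge and, inside each quadrilateral tile, joining by an arc the middle points of one of the two pairs of opposite edges of the tile, such that the middle point of each edge is used exactly once. Given a labelling of some vertices by $\bullet$, the tile types are as follows, where the corners of the pentagon are $v_1,\dots,v_5$ in cyclic order, $v_1,v_3$ carry the label $\bullet$ and $v_2,v_4,v_5$ are unlabelled. $P_1$: the pentagon is non-degenerate. $P_2$: the corners $v_1$ and $v_3$ are the same ($\bullet$-)vertex, with no other identification, and the union of the tile with a small disk neighborhood of this vertex is a Möbius band. $P_3$: the edge $v_2v_3$ is identified with the edge $v_5v_1$ so that $v_2$ is glued to $v_5$ and $v_3$ to $v_1$ (a twisted identification, so the tile is a Möbius band); the tile has the single $\bullet$-vertex $v_1=v_3$ and two unlabelled vertices $v_2=v_5$ and $v_4$. -}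

module Defs where

-- Tilings of compact connected surfaces without boundary are encoded by
-- (finite, connected) generalized maps (gems): a finite set of flags with
-- three fixed-point-free involutions α₀ α₁ α₂ such that α₀ α₂ commute and
-- α₀ ∘ α₂ is fixed-point free.  Vertices / edges / tiles are the orbits of
-- ⟨α₁,α₂⟩ / ⟨α₀,α₂⟩ / ⟨α₀,α₁⟩.

open import Data.Nat using (ℕ; zero; suc; _<_; _≤_)
open import Data.Fin using (Fin)
open import Data.Bool using (Bool; true; false; not; T)
open import Data.Product using (Σ; ∃; _×_; _,_)
open import Data.Sum using (_⊎_)
open import Function.Base using (_∘_)
open import Function.Definitions using (Bijective)
open import Relation.Binary.PropositionalEquality using (_≡_; _≢_; subst; sym; trans; cong)
open import Relation.Nullary using (¬_)

iter : {A : Set} → (A → A) → ℕ → A → A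
iter f zero    x = x
iter f (suc k) x = f (iter f k x)

Period : {A : Set} → (A → A) → A → ℕ → Set
Period f x k = (0 < k) × (iter f k x ≡ x) × (∀ j → 0 < j → j < k → iter f j x ≢ x)

data Orbit₂ {A : Set} (f g : A → A) (x : A) : A → Set where
  here : Orbit₂ f g x x
  by-f : ∀ {y} → Orbit₂ f g x y → Orbit₂ f g x (f y)
  by-g : ∀ {y} → Orbit₂ f g x y → Orbit₂ f g x (g y)

data Orbit₃ {A : Set} (f g h : A → A) (x : A) : A → Set where
  here : Orbit₃ f g h x x
  by-f : ∀ {y} → Orbit₃ f g h x y → Orbit₃ f g h x (f y)
  by-g : ∀ {y} → Orbit₃ f g h x y → Orbit₃ f g h x (g y)
  by-h : ∀ {y} → Orbit₃ f g h x y → Orbit₃ f g h x (h y)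

record GMap : Set where
  field
    size      : ℕ
    nonempty  : 0 < size
    α₀ α₁ α₂  : Fin size → Fin size
    α₀-invol  : ∀ x → α₀ (α₀ x) ≡ x
    α₁-invol  : ∀ x → α₁ (α₁ x) ≡ x
    α₂-invol  : ∀ x → α₂ (α₂ x) ≡ x
    α₀-fpf    : ∀ x → α₀ x ≢ x
    α₁-fpf    : ∀ x → α₁ x ≢ x
    α₂-fpf    : ∀ x → α₂ x ≢ x
    α₀α₂-comm : ∀ x → α₀ (α₂ x) ≡ α₂ (α₀ x)
    α₀α₂-fpf  : ∀ x → α₀ (α₂ x) ≢ x
    connected : ∀ x y → Orbit₃ α₀ α₁ α₂ x y

  Flag : Set
  Flag = Fin size

  -- rotation around a vertex; its period at x is the degree of the vertex of x
  ρ : Flag → Flag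
  ρ = α₂ ∘ α₁

  -- rotation along a tile boundary; its period at x is the number of edges of the tile of x
  σ : Flag → Flag
  σ = α₁ ∘ α₀

  SameVertex : Flag → Flag → Set
  SameVertex = Orbit₂ α₁ α₂

  SameEdge : Flag → Flag → Set
  SameEdge = Orbit₂ α₀ α₂

  SameTile : Flag → Flag → Set
  SameTile = Orbit₂ α₀ α₁

open GMap public

IsTiling : GMap → Set
IsTiling G = (∀ x k → Period (ρ G) x k → 3 ≤ k) × (∀ x k → Period (σ G) x k → 3 ≤ k)

IsPentagonal : GMap → Set
IsPentagonal G = ∀ x → Period (σ G) x 5

IsQuadrilateral : GMap → Set
IsQuadrilateral G = ∀ x → Period (σ G) x 4

-- A choice, in each quadrilateral tile, of one pair of opposite edges.
-- chosen d = true  iff the edge-side of flag d is in the chosen pair of its tile.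
-- (α₁ moves to an adjacent edge-side of the same tile, α₀ stays on the same
-- edge-side; α₂ moves to the other side of the same edge: the midpoint of each
-- edge is used exactly once.)
record Choice (Q : GMap) : Set where
  field
    chosen    : Flag Q → Bool
    chosen-α₀ : ∀ d → chosen (α₀ Q d) ≡ chosen d
    chosen-α₁ : ∀ d → chosen (α₁ Q d) ≡ not (chosen d)
    chosen-α₂ : ∀ d → chosen (α₂ Q d) ≡ not (chosen d)
open Choice public

module Subdivision (Q : GMap) (C : Choice Q) where

  data SFlag : Set where
    corner : Flag Q → SFlag               -- at the old vertex of d, on the half of d's edge near it
    mid    : Flag Q → SFlag               -- at the midpoint of d's edge, same half-edge, same side
    arc    : (d : Flag Q) → T (chosen C d) → SFlag
                                           -- at the midpoint of d's (chosen) edge, on the new arc,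
                                           -- in the pentagon containing the corner of d

  private
    lemma-arc₂ : ∀ d → T (chosen C d) → T (chosen C (α₀ Q d))
    lemma-arc₂ d p = subst T (sym (chosen-α₀ C d)) p

    notnot : ∀ b → not (not b) ≡ b
    notnot true  = Relation.Binary.PropositionalEquality.refl
    notnot false = Relation.Binary.PropositionalEquality.refl

    lemma-arc₀ : ∀ d → T (chosen C d) → T (chosen C (α₁ Q (α₀ Q (α₁ Q d))))
    lemma-arc₀ d p = subst T (sym eq) p
      where
      eq : chosen C (α₁ Q (α₀ Q (α₁ Q d))) ≡ chosen C d
      eq = trans (chosen-α₁ C _)
             (trans (cong not (chosen-α₀ C _))
               (trans (cong not (chosen-α₁ C d)) (notnot _)))

  sα₀ : SFlag → SFlag
  sα₀ (corner d) = mid d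
  sα₀ (mid d)    = corner d
  sα₀ (arc d p)  = arc (α₁ Q (α₀ Q (α₁ Q d))) (lemma-arc₀ d p)

  sα₁-mid : (d : Flag Q) → (b : Bool) → chosen C d ≡ b → SFlag
  sα₁-mid d true  eq = arc d (subst T (sym eq) _)
  sα₁-mid d false eq = mid (α₀ Q d)

  sα₁ : SFlag → SFlag
  sα₁ (corner d) = corner (α₁ Q d)
  sα₁ (mid d)    = sα₁-mid d (chosen C d) Relation.Binary.PropositionalEquality.refl
  sα₁ (arc d p)  = mid d

  sα₂ : SFlag → SFlag
  sα₂ (corner d) = corner (α₂ Q d)
  sα₂ (mid d)    = mid (α₂ Q d)
  sα₂ (arc d p)  = arc (α₀ Q d) (lemma-arc₂ d p)

record IsoToSubdivision (P Q : GMap) (C : Choice Q) : Set where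
  open Subdivision Q C
  field
    to        : Flag P → SFlag
    bijective : Bijective _≡_ _≡_ to
    to-α₀     : ∀ x → to (α₀ P x) ≡ sα₀ (to x)
    to-α₁     : ∀ x → to (α₁ P x) ≡ sα₁ (to x)
    to-α₂     : ∀ x → to (α₂ P x) ≡ sα₂ (to x)

IsSimplePentagonalSubdivision : GMap → Set
IsSimplePentagonalSubdivision P =
  Σ GMap λ Q → IsTiling Q × IsQuadrilateral Q ×
    Σ (Choice Q) λ C → IsoToSubdivision P Q C

-- a labelling of vertices by • (true = labelled), constant on vertices
record Labelling (G : GMap) : Set where
  field
    lab    : Flag G → Bool
    lab-α₁ : ∀ x → lab (α₁ G x) ≡ lab x
    lab-α₂ : ∀ x → lab (α₂ G x) ≡ lab x
open Labelling public

module TileTypes (G : GMap) (L : Labelling G) (x : Flag G) where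
  -- corner flags of the tile of x read from x: c₁ ... c₅ have vertices v₁ ... v₅,
  -- and the edge of cᵢ is vᵢvᵢ₊₁.
  c₁ c₂ c₃ c₄ c₅ : Flag G
  c₁ = x
  c₂ = iter (σ G) 1 x
  c₃ = iter (σ G) 2 x
  c₄ = iter (σ G) 3 x
  c₅ = iter (σ G) 4 x

  _≉ᵥ_ : Flag G → Flag G → Set
  a ≉ᵥ b = ¬ SameVertex G a b

  _≉ₑ_ : Flag G → Flag G → Set
  a ≉ₑ b = ¬ SameEdge G a b

  Labels : Set
  Labels = (lab L c₁ ≡ true) × (lab L c₃ ≡ true) ×
           (lab L c₂ ≡ false) × (lab L c₄ ≡ false) × (lab L c₅ ≡ false)

  P₁ : Set
  P₁ = Labels ×
       (c₁ ≉ᵥ c₂) × (c₁ ≉ᵥ c₃) × (c₁ ≉ᵥ c₄) × (c₁ ≉ᵥ c₅) ×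
       (c₂ ≉ᵥ c₃) × (c₂ ≉ᵥ c₄) × (c₂ ≉ᵥ c₅) ×
       (c₃ ≉ᵥ c₄) × (c₃ ≉ᵥ c₅) × (c₄ ≉ᵥ c₅)

  -- v₁ = v₃, no other identification, tile ∪ neighbourhood of v₁ is a Möbius
  -- band: the corners c₁ and c₃ lie at odd distance in the (even) cycle of
  -- flags around the vertex, i.e. c₃ = ρᵏ (α₁ c₁) for some k.
  P₂ : Set
  P₂ = Labels × SameVertex G c₁ c₃ ×
       (c₁ ≉ᵥ c₂) × (c₁ ≉ᵥ c₄) × (c₁ ≉ᵥ c₅) ×
       (c₂ ≉ᵥ c₄) × (c₂ ≉ᵥ c₅) × (c₄ ≉ᵥ c₅) ×
       (c₁ ≉ₑ c₂) × (c₁ ≉ₑ c₃) × (c₁ ≉ₑ c₄) × (c₁ ≉ₑ c₅) ×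
       (c₂ ≉ₑ c₃) × (c₂ ≉ₑ c₄) × (c₂ ≉ₑ c₅) ×
       (c₃ ≉ₑ c₄) × (c₃ ≉ₑ c₅) × (c₄ ≉ₑ c₅) ×
       (∃ λ k → iter (ρ G) k (α₁ G c₁) ≡ c₃)

  -- edge v₂v₃ glued to edge v₅v₁ with v₂ ↦ v₅, v₃ ↦ v₁ (twisted):
  -- the flag c₅ (at v₅ on v₅v₁) is the flag across the edge from c₂ (at v₂ on v₂v₃).
  -- Vertices: v₁ = v₃, v₂ = v₅, v₄ pairwise distinct; no other edge identification.
  P₃ : Set
  P₃ = Labels × (c₅ ≡ α₂ G c₂) ×
       (c₁ ≉ᵥ c₂) × (c₁ ≉ᵥ c₄) × (c₂ ≉ᵥ c₄) ×
       (c₁ ≉ₑ c₂) × (c₁ ≉ₑ c₃) × (c₁ ≉ₑ c₄) ×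
       (c₂ ≉ₑ c₃) × (c₂ ≉ₑ c₄) × (c₃ ≉ₑ c₄)

GoodLabelling : (G : GMap) → Labelling G → Set
GoodLabelling G L =
  (∀ x → lab L x ≡ false → Period (ρ G) x 3) ×
  (∀ y → Σ (Flag G) λ x → SameTile G y x ×
     (TileTypes.P₁ G L x ⊎ TileTypes.P₂ G L x ⊎ TileTypes.P₃ G L x))

{-# OPTIONS --safe #-}
module Submission where

-- In the simple pentagonal subdivision of a quadrilateral tiling Q, label the vertices of Q by •: the
-- edge midpoints have degree 3, and each pentagon, read from its corner at the end of an unchosen
-- edge, has type P₁, P₂ or P₃ according to which vertices and edges of the quadrilateral of Q around
-- it are identified.
--
-- Conversely, for a good labelling every unlabelled vertex has exactly one unlabelled neighbour, the
-- other end of an arc, and two • neighbours, which it joins into an edge of Q. The flags at •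
-- vertices, with α₁ and α₂ of the pentagonal tiling and α₀ running across these midpoints, form a
-- quadrilateral tiling Q that the arcs subdivide back into the given tiling. The only global step is
-- that an unlabelled vertex never has three • neighbours. Crossing the vertex of an arc flag into the
-- third tile there, where that vertex is v₂, and moving on to the arc of that tile injects the finite
-- set of arc flags into itself; so the arc of every tile is reached this way, which needs an arc at
-- its vertex v₂.

open import Defs
open import Data.Bool using (Bool; true; false; not; if_then_else_; T)
open import Data.Bool.Properties using (T-irrelevant; T-≡; T-not-≡; not-involutive)
open import Data.Empty using (⊥)
open import Data.Empty.Irrelevant using (⊥-elim)
open import Data.Fin using (Fin; toℕ; fromℕ<) renaming (zero to fz; suc to fs)
import Data.Fin.Properties as Fin
open import Data.List using (List; []; _∷_)
open import Data.Nat using (ℕ; zero; suc; _+_; _*_; _<_; _≤_; s≤s; z≤n; NonZero; >-nonZero⁻¹)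
open import Data.Nat.DivMod using (_%_; _/_; m≡m%n+[m/n]*n; m%n<n)
open import Data.Nat.Properties using (*-suc; +-suc; ≤-refl; m≤n⇒∃[o]m+o≡n; <-cmp)
open import Data.Product using (Σ; ∃; _×_; _,_; proj₁; proj₂)
import Data.Product
open import Data.Sum using (_⊎_; inj₁; inj₂; [_,_]′)
import Data.Sum
open import Data.Unit using (⊤; tt)
open import Function.Base using (_∘_)
open import Function.Bundles using (Equivalence)
open import Function.Definitions using (Injective; Surjective)
open import Relation.Binary.Definitions using (tri<; tri≈; tri>)
open import Relation.Binary.PropositionalEquality
open import Relation.Nullary using (Dec; yes; no; ¬_)
open import Relation.Nullary.Decidable using (map′; _⊎-dec_)

private variable
  A B : Set

true≢false : true ≢ false
true≢false ()

involutive⇒injective : (f : A → A) → (∀ x → f (f x) ≡ x) → Injective _≡_ _≡_ f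
involutive⇒injective f f-invol {x} {y} fx≡fy = begin
  x         ≡⟨ f-invol x ⟨
  f (f x)   ≡⟨ cong f fx≡fy ⟩
  f (f y)   ≡⟨ f-invol y ⟩
  y         ∎
  where open ≡-Reasoning

iter-+ : (f : A → A) (m n : ℕ) (x : A) → iter f (m + n) x ≡ iter f m (iter f n x)
iter-+ f zero    n x = refl
iter-+ f (suc m) n x = cong f (iter-+ f m n x)

iter-commute : (f : A → A) (k : ℕ) (x : A) → iter f k (f x) ≡ f (iter f k x)
iter-commute f zero    x = refl
iter-commute f (suc k) x = cong f (iter-commute f k x)

iter-homo : (f : A → A) (g : B → B) (h : A → B) → (∀ x → h (f x) ≡ g (h x)) →
            ∀ k x → h (iter f k x) ≡ iter g k (h x)
iter-homo f g h h-homo zero    x = refl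
iter-homo f g h h-homo (suc k) x = trans (h-homo _) (cong g (iter-homo f g h h-homo k x))

iter-injective : (f : A → A) → Injective _≡_ _≡_ f → ∀ k {x y} → iter f k x ≡ iter f k y → x ≡ y
iter-injective f f-inj zero    eq = eq
iter-injective f f-inj (suc k) eq = iter-injective f f-inj k (f-inj eq)

iter-*-periodic : (f : A → A) (p : ℕ) (x : A) → iter f p x ≡ x → ∀ q → iter f (q * p) x ≡ x
iter-*-periodic f p x fᵖx≡x zero    = refl
iter-*-periodic f p x fᵖx≡x (suc q) = begin
  iter f (p + q * p) x       ≡⟨ iter-+ f p (q * p) x ⟩
  iter f p (iter f (q * p) x) ≡⟨ cong (iter f p) (iter-*-periodic f p x fᵖx≡x q) ⟩
  iter f p x                  ≡⟨ fᵖx≡x ⟩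
  x                           ∎
  where open ≡-Reasoning

iter-% : (f : A → A) (x : A) (p : ℕ) .{{_ : NonZero p}} → iter f p x ≡ x →
         ∀ k → iter f k x ≡ iter f (k % p) x
iter-% f x p fᵖx≡x k = begin
  iter f k x                              ≡⟨ cong (λ m → iter f m x) (m≡m%n+[m/n]*n k p) ⟩
  iter f (k % p + k / p * p) x            ≡⟨ iter-+ f (k % p) (k / p * p) x ⟩
  iter f (k % p) (iter f (k / p * p) x)   ≡⟨ cong (iter f (k % p)) (iter-*-periodic f p x fᵖx≡x (k / p)) ⟩
  iter f (k % p) x                        ∎
  where open ≡-Reasoning

iter-undo : (f : A → A) (x : A) (p : ℕ) → iter f (suc p) x ≡ x →
            ∀ k → ∃ λ m → iter f k (iter f m x) ≡ x
iter-undo f x p fᵖ⁺¹x≡x k = k * p , (begin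
  iter f k (iter f (k * p) x) ≡⟨ iter-+ f k (k * p) x ⟨
  iter f (k + k * p) x        ≡⟨ cong (λ m → iter f m x) (*-suc k p) ⟨
  iter f (k * suc p) x        ≡⟨ iter-*-periodic f (suc p) x fᵖ⁺¹x≡x k ⟩
  x                           ∎)
  where open ≡-Reasoning

module _ {n : ℕ} (f : Fin n → Fin n) (f-inj : Injective _≡_ _≡_ f) where

  iter-returns : ∀ x → ∃ λ p → iter f (suc p) x ≡ x
  iter-returns x with Fin.pigeonhole ≤-refl (λ (i : Fin (suc n)) → iter f (toℕ i) x)
  ... | i , j , i<j , fⁱx≡fʲx with m≤n⇒∃[o]m+o≡n i<j
  ...   | p , i+1+p≡j = p , iter-injective f f-inj (toℕ i) (begin
    iter f (toℕ i) (iter f (suc p) x) ≡⟨ iter-+ f (toℕ i) (suc p) x ⟨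
    iter f (toℕ i + suc p) x          ≡⟨ cong (λ m → iter f m x) (trans (+-suc (toℕ i) p) i+1+p≡j) ⟩
    iter f (toℕ j) x                  ≡⟨ fⁱx≡fʲx ⟨
    iter f (toℕ i) x                  ∎)
    where open ≡-Reasoning

  invariant-preimage : (I : Fin n → Set) → (∀ x → I x → I (f x)) →
                       ∀ x → I x → ∃ λ y → I y × f y ≡ x
  invariant-preimage I f-pres x Ix with iter-returns x
  ... | p , fᵖ⁺¹x≡x = iter f p x , iter-invariant p , fᵖ⁺¹x≡x
    where
    iter-invariant : ∀ k → I (iter f k x)
    iter-invariant zero    = Ix
    iter-invariant (suc k) = f-pres _ (iter-invariant k)

module _ {f : A → A} where

  Period-unique : ∀ {x m n} → Period f x m → Period f x n → m ≡ n
  Period-unique {m = m} {n} (0<m , fᵐ , m-min) (0<n , fⁿ , n-min) with <-cmp m n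
  ... | tri< m<n _ _ = ⊥-elim (n-min m 0<m m<n fᵐ)
  ... | tri≈ _ m≡n _ = m≡n
  ... | tri> _ _ n<m = ⊥-elim (m-min n 0<n n<m fⁿ)

  Period-shift : Injective _≡_ _≡_ f → ∀ {x n} → Period f x n → Period f (f x) n
  Period-shift f-inj {x} {n} (0<n , fⁿ , n-min) =
    0<n , trans (iter-commute f n x) (cong f fⁿ) ,
    λ j 0<j j<n fʲ → n-min j 0<j j<n (f-inj (trans (sym (iter-commute f j x)) fʲ))

  module _ {g : B → B} (h : A → B) (h-inj : Injective _≡_ _≡_ h) (h-homo : ∀ x → h (f x) ≡ g (h x)) where

    Period-map : ∀ {x n} → Period f x n → Period g (h x) n
    Period-map {x} {n} (0<n , fⁿ , n-min) =
      0<n , trans (sym (iter-homo f g h h-homo n x)) (cong h fⁿ) ,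
      λ j 0<j j<n gʲ → n-min j 0<j j<n (h-inj (trans (iter-homo f g h h-homo j x) gʲ))

    Period-reflect : ∀ {x n} → Period g (h x) n → Period f x n
    Period-reflect {x} {n} (0<n , gⁿ , n-min) =
      0<n , h-inj (trans (iter-homo f g h h-homo n x) gⁿ) ,
      λ j 0<j j<n fʲ → n-min j 0<j j<n (trans (sym (iter-homo f g h h-homo j x)) (cong h fʲ))

record ThreeCycle (f : A → A) (a b c : A) : Set where
  field
    fa≡b : f a ≡ b
    fb≡c : f b ≡ c
    fc≡a : f c ≡ a
    a≢b  : a ≢ b
    b≢c  : b ≢ c
    c≢a  : c ≢ a

module _ {f : A → A} {a b c : A} (cycle : ThreeCycle f a b c) where
  open ThreeCycle cycle

  ThreeCycle-rotate : ThreeCycle f b c a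
  ThreeCycle-rotate = record
    { fa≡b = fb≡c ; fb≡c = fc≡a ; fc≡a = fa≡b ; a≢b = b≢c ; b≢c = c≢a ; c≢a = a≢b }

  ThreeCycle⇒Period : Period f a 3
  ThreeCycle⇒Period = s≤s z≤n , trans (cong f (trans (cong f fa≡b) fb≡c)) fc≡a , λ where
    0 () _
    1 _ _ fa≡a → a≢b (trans (sym fa≡a) fa≡b)
    2 _ _ f²a≡a → c≢a (trans (sym (trans (cong f fa≡b) fb≡c)) f²a≡a)
    (suc (suc (suc _))) _ (s≤s (s≤s (s≤s ())))

module _ {f g : A → A} where

  Orbit₂-trans : ∀ {x y z} → Orbit₂ f g x y → Orbit₂ f g y z → Orbit₂ f g x z
  Orbit₂-trans o here     = o
  Orbit₂-trans o (by-f p) = by-f (Orbit₂-trans o p)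
  Orbit₂-trans o (by-g p) = by-g (Orbit₂-trans o p)

  Orbit₂-sym : (∀ x → f (f x) ≡ x) → (∀ x → g (g x) ≡ x) → ∀ {x y} → Orbit₂ f g x y → Orbit₂ f g y x
  Orbit₂-sym f-invol g-invol here = here
  Orbit₂-sym f-invol g-invol (by-f {y} o) =
    Orbit₂-trans (subst (Orbit₂ f g (f y)) (f-invol y) (by-f here)) (Orbit₂-sym f-invol g-invol o)
  Orbit₂-sym f-invol g-invol (by-g {y} o) =
    Orbit₂-trans (subst (Orbit₂ f g (g y)) (g-invol y) (by-g here)) (Orbit₂-sym f-invol g-invol o)

  Orbit₂-invariant : (I : A → Set) → (∀ x → I x → I (f x)) → (∀ x → I x → I (g x)) →
                     ∀ {x y} → Orbit₂ f g x y → I x → I y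
  Orbit₂-invariant I f-pres g-pres here     Ix = Ix
  Orbit₂-invariant I f-pres g-pres (by-f o) Ix = f-pres _ (Orbit₂-invariant I f-pres g-pres o Ix)
  Orbit₂-invariant I f-pres g-pres (by-g o) Ix = g-pres _ (Orbit₂-invariant I f-pres g-pres o Ix)

  Orbit₂-map : {F G : B → B} (h : A → B) → (∀ x → h (f x) ≡ F (h x)) → (∀ x → h (g x) ≡ G (h x)) →
               ∀ {x y} → Orbit₂ f g x y → Orbit₂ F G (h x) (h y)
  Orbit₂-map {F = F} {G} h hf hg {x} here = here
  Orbit₂-map {F = F} {G} h hf hg {x} (by-f {y} o) =
    subst (Orbit₂ F G (h x)) (sym (hf y)) (by-f (Orbit₂-map h hf hg o))
  Orbit₂-map {F = F} {G} h hf hg {x} (by-g {y} o) =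
    subst (Orbit₂ F G (h x)) (sym (hg y)) (by-g (Orbit₂-map h hf hg o))

Orbit₂-separates : ∀ {f g : A → A} (I : A → Set) → (∀ x → I x → I (f x)) → (∀ x → I x → I (g x)) →
                   ∀ {x y} → I x → ¬ I y → ¬ Orbit₂ f g x y
Orbit₂-separates I f-pres g-pres Ix ¬Iy o = ¬Iy (Orbit₂-invariant I f-pres g-pres o Ix)

Orbit₃-trans : ∀ {f g h : A → A} {x y z} → Orbit₃ f g h x y → Orbit₃ f g h y z → Orbit₃ f g h x z
Orbit₃-trans o here     = o
Orbit₃-trans o (by-f p) = by-f (Orbit₃-trans o p)
Orbit₃-trans o (by-g p) = by-g (Orbit₃-trans o p)
Orbit₃-trans o (by-h p) = by-h (Orbit₃-trans o p)

record Enumeration (n : ℕ) (p : Fin n → Bool) : Set where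
  field
    count         : ℕ
    index         : (x : Fin n) → .(p x ≡ true) → Fin count
    element       : Fin count → Fin n
    element-valid : ∀ i → p (element i) ≡ true
    element-index : ∀ x .(px : p x ≡ true) → element (index x px) ≡ x
    index-element : ∀ i .(pi : p (element i) ≡ true) → index (element i) pi ≡ i

  index-cong : ∀ {x y} .{px : p x ≡ true} .{py : p y ≡ true} → x ≡ y → index x px ≡ index y py
  index-cong refl = refl

  index-injective : ∀ {x y} .{px : p x ≡ true} .{py : p y ≡ true} → index x px ≡ index y py → x ≡ y
  index-injective {x} {y} {px} {py} eq =
    trans (sym (element-index x px)) (trans (cong element eq) (element-index y py))

  element-injective : Injective _≡_ _≡_ element
  element-injective {i} {j} eq =
    trans (sym (index-element i (element-valid i)))
          (trans (index-cong eq) (index-element j (element-valid j)))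

  restrict : (f : Fin n → Fin n) → (∀ x → p x ≡ true → p (f x) ≡ true) → Fin count → Fin count
  restrict f f-pres i = index (f (element i)) (f-pres (element i) (element-valid i))

  element-restrict : ∀ f f-pres i → element (restrict f f-pres i) ≡ f (element i)
  element-restrict f f-pres i = element-index _ _

  restrict-index : ∀ f f-pres {x} .(px : p x ≡ true) →
                   restrict f f-pres (index x px) ≡ index (f x) (f-pres x px)
  restrict-index f f-pres {x} px = index-cong (cong f (element-index x px))

  element-restrict₂ : ∀ f f-pres g g-pres i →
                      element (restrict f f-pres (restrict g g-pres i)) ≡ f (g (element i))
  element-restrict₂ f f-pres g g-pres i =
    trans (element-restrict f f-pres _) (cong f (element-restrict g g-pres i))

  module _ {f g : Fin n → Fin n} (f-pres : ∀ x → p x ≡ true → p (f x) ≡ true)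
           (g-pres : ∀ x → p x ≡ true → p (g x) ≡ true) where

    restrict-comm : (∀ x → p x ≡ true → f (g x) ≡ g (f x)) →
                    ∀ i → restrict f f-pres (restrict g g-pres i) ≡ restrict g g-pres (restrict f f-pres i)
    restrict-comm comm i = element-injective
      (trans (element-restrict₂ f f-pres g g-pres i)
        (trans (comm _ (element-valid i)) (sym (element-restrict₂ g g-pres f f-pres i))))

    restrict-∘-fpf : (∀ x → p x ≡ true → f (g x) ≢ x) → ∀ i → restrict f f-pres (restrict g g-pres i) ≢ i
    restrict-∘-fpf fpf i eq =
      fpf _ (element-valid i) (trans (sym (element-restrict₂ f f-pres g g-pres i)) (cong element eq))

  module _ {f : Fin n → Fin n} (f-pres : ∀ x → p x ≡ true → p (f x) ≡ true) where

    restrict-involutive : (∀ x → p x ≡ true → f (f x) ≡ x) → ∀ i → restrict f f-pres (restrict f f-pres i) ≡ i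
    restrict-involutive invol i = element-injective
      (trans (element-restrict₂ f f-pres f f-pres i) (invol _ (element-valid i)))

    restrict-fpf : (∀ x → p x ≡ true → f x ≢ x) → ∀ i → restrict f f-pres i ≢ i
    restrict-fpf fpf i eq = fpf _ (element-valid i) (trans (sym (element-restrict f f-pres i)) (cong element eq))

enumerate : ∀ n (p : Fin n → Bool) → Enumeration n p
enumerate zero p = record
  { count = 0 ; index = λ () ; element = λ () ; element-valid = λ ()
  ; element-index = λ () ; index-element = λ () }
enumerate (suc n) p with p fz in p0 | enumerate n (p ∘ fs)
... | true | E = record
  { count = suc count ; index = index′ ; element = element′ ; element-valid = element′-valid
  ; element-index = element′-index ; index-element = index′-element }
  where
  open Enumeration E
  index′ : (x : Fin (suc n)) → .(p x ≡ true) → Fin (suc count)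
  index′ fz     _  = fz
  index′ (fs x) px = fs (index x px)
  element′ : Fin (suc count) → Fin (suc n)
  element′ fz     = fz
  element′ (fs i) = fs (element i)
  element′-valid : ∀ i → p (element′ i) ≡ true
  element′-valid fz     = p0
  element′-valid (fs i) = element-valid i
  element′-index : ∀ x .(px : p x ≡ true) → element′ (index′ x px) ≡ x
  element′-index fz     _  = refl
  element′-index (fs x) px = cong fs (element-index x px)
  index′-element : ∀ i .(pi : p (element′ i) ≡ true) → index′ (element′ i) pi ≡ i
  index′-element fz     _  = refl
  index′-element (fs i) pi = cong fs (index-element i pi)
... | false | E = record
  { count = count ; index = index′ ; element = fs ∘ element ; element-valid = element-valid
  ; element-index = element′-index ; index-element = index-element }
  where
  open Enumeration E
  index′ : (x : Fin (suc n)) → .(p x ≡ true) → Fin count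
  index′ fz     p0≡true = ⊥-elim (true≢false (trans (sym p0≡true) p0))
  index′ (fs x) px      = index x px
  element′-index : ∀ x .(px : p x ≡ true) → fs (element (index′ x px)) ≡ x
  element′-index fz     p0≡true = ⊥-elim (true≢false (trans (sym p0≡true) p0))
  element′-index (fs x) px      = cong fs (element-index x px)

module GMapOrbits (G : GMap) where
  module G = GMap G

  ρ-injective : Injective _≡_ _≡_ G.ρ
  ρ-injective = involutive⇒injective G.α₁ G.α₁-invol ∘ involutive⇒injective G.α₂ G.α₂-invol

  α₂≡ρ∘α₁ : ∀ x → G.α₂ x ≡ G.ρ (G.α₁ x)
  α₂≡ρ∘α₁ x = sym (cong G.α₂ (G.α₁-invol x))

  α₁-conjugates-ρ-to-ρ⁻¹ : ∀ x → G.ρ (G.α₁ (G.ρ x)) ≡ G.α₁ x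
  α₁-conjugates-ρ-to-ρ⁻¹ x = trans (cong G.α₂ (G.α₁-invol (G.α₂ (G.α₁ x)))) (G.α₂-invol (G.α₁ x))

  α₁-conjugates-ρᵏ-to-ρ⁻ᵏ : ∀ k x → iter G.ρ k (G.α₁ (iter G.ρ k x)) ≡ G.α₁ x
  α₁-conjugates-ρᵏ-to-ρ⁻ᵏ zero    x = refl
  α₁-conjugates-ρᵏ-to-ρ⁻ᵏ (suc k) x = begin
    iter G.ρ (suc k) (G.α₁ (G.ρ (iter G.ρ k x)))   ≡⟨ iter-commute G.ρ k _ ⟨
    iter G.ρ k (G.ρ (G.α₁ (G.ρ (iter G.ρ k x))))   ≡⟨ cong (iter G.ρ k) (α₁-conjugates-ρ-to-ρ⁻¹ _) ⟩
    iter G.ρ k (G.α₁ (iter G.ρ k x))               ≡⟨ α₁-conjugates-ρᵏ-to-ρ⁻ᵏ k x ⟩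
    G.α₁ x                                         ∎
    where open ≡-Reasoning

  α₁∘ρᵏ : ∀ k x → ∃ λ m → G.α₁ (iter G.ρ k x) ≡ iter G.ρ m (G.α₁ x)
  α₁∘ρᵏ k x with iter-returns G.ρ ρ-injective (G.α₁ x)
  ... | p , ρᵖ⁺¹α₁x≡α₁x with iter-undo G.ρ (G.α₁ x) p ρᵖ⁺¹α₁x≡α₁x k
  ...   | m , ρᵏρᵐα₁x≡α₁x = m , iter-injective G.ρ ρ-injective k
          (trans (α₁-conjugates-ρᵏ-to-ρ⁻ᵏ k x) (sym ρᵏρᵐα₁x≡α₁x))

  ρ-Orbit : G.Flag → G.Flag → Set
  ρ-Orbit x y = ∃ λ k → iter G.ρ k x ≡ y

  ρ-orbit? : ∀ x y → Dec (ρ-Orbit x y)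
  ρ-orbit? x y with iter-returns G.ρ ρ-injective x
  ... | p , ρᵖ⁺¹x≡x = map′ (λ (i , eq) → toℕ i , eq) reduce
                           (Fin.any? λ i → iter G.ρ (toℕ i) x Fin.≟ y)
    where
    reduce : ρ-Orbit x y → ∃ λ (i : Fin (suc p)) → iter G.ρ (toℕ i) x ≡ y
    reduce (k , ρᵏx≡y) = fromℕ< (m%n<n k (suc p)) , (begin
      iter G.ρ (toℕ (fromℕ< (m%n<n k (suc p)))) x ≡⟨ cong (λ m → iter G.ρ m x) (Fin.toℕ-fromℕ< (m%n<n k (suc p))) ⟩
      iter G.ρ (k % suc p) x                     ≡⟨ iter-% G.ρ x (suc p) ρᵖ⁺¹x≡x k ⟨
      iter G.ρ k x                               ≡⟨ ρᵏx≡y ⟩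
      y                                          ∎)
      where open ≡-Reasoning

  sameVertex⇒ρ-orbit : ∀ {x y} → SameVertex G x y → ρ-Orbit x y ⊎ ρ-Orbit (G.α₁ x) y
  sameVertex⇒ρ-orbit here = inj₁ (0 , refl)
  sameVertex⇒ρ-orbit {x} (by-f o) with sameVertex⇒ρ-orbit o
  ... | inj₁ (k , refl) = let m , eq = α₁∘ρᵏ k x in inj₂ (m , sym eq)
  ... | inj₂ (k , refl) = let m , eq = α₁∘ρᵏ k (G.α₁ x) in
                          inj₁ (m , sym (trans eq (cong (iter G.ρ m) (G.α₁-invol x))))
  sameVertex⇒ρ-orbit {x} (by-g o) with sameVertex⇒ρ-orbit o
  ... | inj₁ (k , refl) = let m , eq = α₁∘ρᵏ k x in
                          inj₂ (suc m , sym (trans (α₂≡ρ∘α₁ _) (cong G.ρ eq)))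
  ... | inj₂ (k , refl) = let m , eq = α₁∘ρᵏ k (G.α₁ x) in
                          inj₁ (suc m , sym (trans (α₂≡ρ∘α₁ _)
                            (cong G.ρ (trans eq (cong (iter G.ρ m) (G.α₁-invol x))))))

  ρ-orbit⇒sameVertex : ∀ {x y} → ρ-Orbit x y → SameVertex G x y
  ρ-orbit⇒sameVertex (zero  , refl) = here
  ρ-orbit⇒sameVertex (suc k , refl) = by-g (by-f (ρ-orbit⇒sameVertex (k , refl)))

  sameVertex? : ∀ x y → Dec (SameVertex G x y)
  sameVertex? x y = map′
    [ ρ-orbit⇒sameVertex , Orbit₂-trans (by-f here) ∘ ρ-orbit⇒sameVertex ]′
    sameVertex⇒ρ-orbit
    (ρ-orbit? x y ⊎-dec ρ-orbit? (G.α₁ x) y)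

  EdgeFlag : G.Flag → G.Flag → Set
  EdgeFlag x y = x ≡ y ⊎ G.α₀ x ≡ y ⊎ G.α₂ x ≡ y ⊎ G.α₀ (G.α₂ x) ≡ y

  sameEdge⇒edgeFlag : ∀ {x y} → SameEdge G x y → EdgeFlag x y
  sameEdge⇒edgeFlag here = inj₁ refl
  sameEdge⇒edgeFlag {x} (by-f o) with sameEdge⇒edgeFlag o
  ... | inj₁ refl                 = inj₂ (inj₁ refl)
  ... | inj₂ (inj₁ refl)          = inj₁ (sym (G.α₀-invol x))
  ... | inj₂ (inj₂ (inj₁ refl))   = inj₂ (inj₂ (inj₂ refl))
  ... | inj₂ (inj₂ (inj₂ refl))   = inj₂ (inj₂ (inj₁ (sym (G.α₀-invol _))))
  sameEdge⇒edgeFlag {x} (by-g o) with sameEdge⇒edgeFlag o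
  ... | inj₁ refl                 = inj₂ (inj₂ (inj₁ refl))
  ... | inj₂ (inj₁ refl)          = inj₂ (inj₂ (inj₂ (G.α₀α₂-comm x)))
  ... | inj₂ (inj₂ (inj₁ refl))   = inj₁ (sym (G.α₂-invol x))
  ... | inj₂ (inj₂ (inj₂ refl))   =
        inj₂ (inj₁ (sym (trans (sym (G.α₀α₂-comm (G.α₂ x))) (cong G.α₀ (G.α₂-invol x)))))

  edgeFlag⇒sameEdge : ∀ {x y} → EdgeFlag x y → SameEdge G x y
  edgeFlag⇒sameEdge (inj₁ refl)               = here
  edgeFlag⇒sameEdge (inj₂ (inj₁ refl))        = by-f here
  edgeFlag⇒sameEdge (inj₂ (inj₂ (inj₁ refl))) = by-g here
  edgeFlag⇒sameEdge (inj₂ (inj₂ (inj₂ refl))) = by-f (by-g here)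

  sameEdge? : ∀ x y → Dec (SameEdge G x y)
  sameEdge? x y = map′ edgeFlag⇒sameEdge sameEdge⇒edgeFlag
    (x Fin.≟ y ⊎-dec G.α₀ x Fin.≟ y ⊎-dec G.α₂ x Fin.≟ y ⊎-dec G.α₀ (G.α₂ x) Fin.≟ y)

  sameVertex-sym : ∀ {x y} → SameVertex G x y → SameVertex G y x
  sameVertex-sym = Orbit₂-sym G.α₁-invol G.α₂-invol

  sameEdge-sym : ∀ {x y} → SameEdge G x y → SameEdge G y x
  sameEdge-sym = Orbit₂-sym G.α₀-invol G.α₂-invol

module SubdivisionSteps (Q : GMap) (C : Choice Q) where
  open Subdivision Q C

  sflagIndex : SFlag → Flag Q
  sflagIndex (corner d) = d
  sflagIndex (mid d)    = d
  sflagIndex (arc d _)  = d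

  arc-cong : ∀ {d e} {p : T (chosen C d)} {q : T (chosen C e)} → d ≡ e → arc d p ≡ arc e q
  arc-cong {p = p} refl = cong (arc _) (T-irrelevant p _)

  sα₁-mid-unchosen : ∀ {d} → chosen C d ≡ false → sα₁ (mid d) ≡ mid (α₀ Q d)
  sα₁-mid-unchosen {d} = unchosen (chosen C d) refl
    where
    unchosen : ∀ b (eq : chosen C d ≡ b) → b ≡ false → sα₁-mid d b eq ≡ mid (α₀ Q d)
    unchosen false _ _ = refl

  sα₁-mid-chosen : ∀ {d} (p : T (chosen C d)) → sα₁ (mid d) ≡ arc d p
  sα₁-mid-chosen {d} p = chosen′ (chosen C d) refl p
    where
    chosen′ : ∀ b (eq : chosen C d ≡ b) → T b → sα₁-mid d b eq ≡ arc d p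
    chosen′ true _ _ = cong (arc d) (T-irrelevant _ p)

-- The ten flags of a pentagon v₁ … v₅ with • at v₁ and v₃: f₂ⱼ lies at vⱼ₊₁ on the edge vⱼ₊₁vⱼ₊₂,
-- and f₂ⱼ₊₁ = α₀ f₂ⱼ at the other end of that edge.
data PentagonFlag : Set where
  f₀ f₁ f₂ f₃ f₄ f₅ f₆ f₇ f₈ f₉ : PentagonFlag

pα₀ : PentagonFlag → PentagonFlag
pα₀ f₀ = f₁
pα₀ f₁ = f₀
pα₀ f₂ = f₃
pα₀ f₃ = f₂
pα₀ f₄ = f₅
pα₀ f₅ = f₄
pα₀ f₆ = f₇
pα₀ f₇ = f₆
pα₀ f₈ = f₉
pα₀ f₉ = f₈

pα₁ : PentagonFlag → PentagonFlag
pα₁ f₀ = f₉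
pα₁ f₁ = f₂
pα₁ f₂ = f₁
pα₁ f₃ = f₄
pα₁ f₄ = f₃
pα₁ f₅ = f₆
pα₁ f₆ = f₅
pα₁ f₇ = f₈
pα₁ f₈ = f₇
pα₁ f₉ = f₀

p• : PentagonFlag → Bool
p• f₀ = true
p• f₁ = false
p• f₂ = false
p• f₃ = true
p• f₄ = true
p• f₅ = false
p• f₆ = false
p• f₇ = false
p• f₈ = false
p• f₉ = true

data Generator : Set where
  a₀ a₁ : Generator

-- A word acts by composition, its head letter applied last.
act : (A → A) → (A → A) → List Generator → A → A
act f g []       x = x
act f g (a₀ ∷ w) x = f (act f g w x)
act f g (a₁ ∷ w) x = g (act f g w x)

act-homo : {f g : A → A} {F G : B → B} (h : A → B) → (∀ x → h (f x) ≡ F (h x)) → (∀ x → h (g x) ≡ G (h x)) →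
           ∀ w x → h (act f g w x) ≡ act F G w (h x)
act-homo h hf hg []       x = refl
act-homo {F = F} h hf hg (a₀ ∷ w) x = trans (hf _) (cong F (act-homo h hf hg w x))
act-homo {G = G} h hf hg (a₁ ∷ w) x = trans (hg _) (cong G (act-homo h hf hg w x))

-- From a good labelling to a quadrilateral tiling

module FromLabelling (P : GMap) (pentagonal : IsPentagonal P) (L : Labelling P) (good : GoodLabelling P L) where
  module P = GMap P

  • : P.Flag → Bool
  • = lab L

  far• : P.Flag → Bool
  far• x = • (P.α₀ x)

  •-α₁ : ∀ x → • (P.α₁ x) ≡ • x
  •-α₁ = lab-α₁ L

  •-α₂ : ∀ x → • (P.α₂ x) ≡ • x
  •-α₂ = lab-α₂ L

  far•-α₀ : ∀ x → far• (P.α₀ x) ≡ • x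
  far•-α₀ x = cong • (P.α₀-invol x)

  far•-α₂ : ∀ x → far• (P.α₂ x) ≡ far• x
  far•-α₂ x = trans (cong • (P.α₀α₂-comm x)) (•-α₂ (P.α₀ x))

  pentagonFlag : P.Flag → PentagonFlag → P.Flag
  pentagonFlag x f₀ = x
  pentagonFlag x f₁ = P.α₀ x
  pentagonFlag x f₂ = P.α₁ (P.α₀ x)
  pentagonFlag x f₃ = P.α₀ (P.α₁ (P.α₀ x))
  pentagonFlag x f₄ = P.α₁ (P.α₀ (P.α₁ (P.α₀ x)))
  pentagonFlag x f₅ = P.α₀ (P.α₁ (P.α₀ (P.α₁ (P.α₀ x))))
  pentagonFlag x f₆ = P.α₁ (P.α₀ (P.α₁ (P.α₀ (P.α₁ (P.α₀ x)))))
  pentagonFlag x f₇ = P.α₀ (P.α₁ (P.α₀ (P.α₁ (P.α₀ (P.α₁ (P.α₀ x))))))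
  pentagonFlag x f₈ = P.α₁ (P.α₀ (P.α₁ (P.α₀ (P.α₁ (P.α₀ (P.α₁ (P.α₀ x)))))))
  pentagonFlag x f₉ = P.α₀ (P.α₁ (P.α₀ (P.α₁ (P.α₀ (P.α₁ (P.α₀ (P.α₁ (P.α₀ x))))))))

  pentagonFlag-α₀ : ∀ x i → pentagonFlag x (pα₀ i) ≡ P.α₀ (pentagonFlag x i)
  pentagonFlag-α₀ x f₀ = refl
  pentagonFlag-α₀ x f₁ = sym (P.α₀-invol x)
  pentagonFlag-α₀ x f₂ = refl
  pentagonFlag-α₀ x f₃ = sym (P.α₀-invol _)
  pentagonFlag-α₀ x f₄ = refl
  pentagonFlag-α₀ x f₅ = sym (P.α₀-invol _)
  pentagonFlag-α₀ x f₆ = refl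
  pentagonFlag-α₀ x f₇ = sym (P.α₀-invol _)
  pentagonFlag-α₀ x f₈ = refl
  pentagonFlag-α₀ x f₉ = sym (P.α₀-invol _)

  σ⁵≡id : ∀ x → iter P.σ 5 x ≡ x
  σ⁵≡id x = proj₁ (proj₂ (pentagonal x))

  pentagonFlag-α₁ : ∀ x i → pentagonFlag x (pα₁ i) ≡ P.α₁ (pentagonFlag x i)
  pentagonFlag-α₁ x f₀ = trans (sym (P.α₁-invol _)) (cong P.α₁ (σ⁵≡id x))
  pentagonFlag-α₁ x f₁ = refl
  pentagonFlag-α₁ x f₂ = sym (P.α₁-invol _)
  pentagonFlag-α₁ x f₃ = refl
  pentagonFlag-α₁ x f₄ = sym (P.α₁-invol _)
  pentagonFlag-α₁ x f₅ = refl
  pentagonFlag-α₁ x f₆ = sym (P.α₁-invol _)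
  pentagonFlag-α₁ x f₇ = refl
  pentagonFlag-α₁ x f₈ = sym (P.α₁-invol _)
  pentagonFlag-α₁ x f₉ = sym (σ⁵≡id x)

  pentagonFlag-• : ∀ {x} → TileTypes.Labels P L x → ∀ i → • (pentagonFlag x i) ≡ p• i
  pentagonFlag-• (v₁ , v₃ , v₂ , v₄ , v₅) f₀ = v₁
  pentagonFlag-• (v₁ , v₃ , v₂ , v₄ , v₅) f₁ = trans (sym (•-α₁ _)) v₂
  pentagonFlag-• (v₁ , v₃ , v₂ , v₄ , v₅) f₂ = v₂
  pentagonFlag-• (v₁ , v₃ , v₂ , v₄ , v₅) f₃ = trans (sym (•-α₁ _)) v₃
  pentagonFlag-• (v₁ , v₃ , v₂ , v₄ , v₅) f₄ = v₃
  pentagonFlag-• (v₁ , v₃ , v₂ , v₄ , v₅) f₅ = trans (sym (•-α₁ _)) v₄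
  pentagonFlag-• (v₁ , v₃ , v₂ , v₄ , v₅) f₆ = v₄
  pentagonFlag-• (v₁ , v₃ , v₂ , v₄ , v₅) f₇ = trans (sym (•-α₁ _)) v₅
  pentagonFlag-• (v₁ , v₃ , v₂ , v₄ , v₅) f₈ = v₅
  pentagonFlag-• {x} (v₁ , v₃ , v₂ , v₄ , v₅) f₉ = trans (sym (•-α₁ _)) (trans (cong • (σ⁵≡id x)) v₁)

  sameTile⇒pentagonFlag : ∀ {x y} → SameTile P x y → ∃ λ i → pentagonFlag x i ≡ y
  sameTile⇒pentagonFlag here = f₀ , refl
  sameTile⇒pentagonFlag {x} (by-f o) with sameTile⇒pentagonFlag o
  ... | i , refl = pα₀ i , pentagonFlag-α₀ x i
  sameTile⇒pentagonFlag {x} (by-g o) with sameTile⇒pentagonFlag o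
  ... | i , refl = pα₁ i , pentagonFlag-α₁ x i

  record Located (y : P.Flag) : Set where
    field
      base    : P.Flag
      labels  : TileTypes.Labels P L base
      slot    : PentagonFlag
      located : pentagonFlag base slot ≡ y

  locate : ∀ y → Located y
  locate y with proj₂ good y
  ... | x , y~x , type with sameTile⇒pentagonFlag (Orbit₂-sym P.α₀-invol P.α₁-invol y~x)
  ... | i , eq = record { base = x ; labels = labelsOf type ; slot = i ; located = eq }
    where
    labelsOf : TileTypes.P₁ P L x ⊎ TileTypes.P₂ P L x ⊎ TileTypes.P₃ P L x → TileTypes.Labels P L x
    labelsOf (inj₁ t)        = proj₁ t
    labelsOf (inj₂ (inj₁ t)) = proj₁ t
    labelsOf (inj₂ (inj₂ t)) = proj₁ t

  module _ {y : P.Flag} (l : Located y) where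
    open Located l

    •-act : ∀ w → • (act P.α₀ P.α₁ w y) ≡ p• (act pα₀ pα₁ w slot)
    •-act w rewrite sym located =
      trans (cong • (sym (act-homo (pentagonFlag base) (pentagonFlag-α₀ base) (pentagonFlag-α₁ base) w slot)))
            (pentagonFlag-• labels _)

    slot-• : ∀ w {b} → • (act P.α₀ P.α₁ w y) ≡ b → p• (act pα₀ pα₁ w slot) ≡ b
    slot-• w eq = trans (sym (•-act w)) eq

    act-≡ : ∀ w w′ → act pα₀ pα₁ w slot ≡ act pα₀ pα₁ w′ slot → act P.α₀ P.α₁ w y ≡ act P.α₀ P.α₁ w′ y
    act-≡ w w′ eq rewrite sym located = begin
      act P.α₀ P.α₁ w (pentagonFlag base slot)  ≡⟨ act-homo (pentagonFlag base) (pentagonFlag-α₀ base) (pentagonFlag-α₁ base) w slot ⟨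
      pentagonFlag base (act pα₀ pα₁ w slot)    ≡⟨ cong (pentagonFlag base) eq ⟩
      pentagonFlag base (act pα₀ pα₁ w′ slot)   ≡⟨ act-homo (pentagonFlag base) (pentagonFlag-α₀ base) (pentagonFlag-α₁ base) w′ slot ⟩
      act P.α₀ P.α₁ w′ (pentagonFlag base slot) ∎
      where open ≡-Reasoning

  open Located using (slot)

  IsArc : P.Flag → Set
  IsArc x = • x ≡ false × far• x ≡ false

  -- For d at a • vertex: the edge of the quadrilateral tiling through d stays inside the tile of d.
  straight : P.Flag → Bool
  straight d = far• (P.σ d)

  -- Each local fact about a tile below is checked on the model pentagon and transported by locate.
  •-far-unlabelled : ∀ y → • y ≡ true → far• y ≡ false
  •-far-unlabelled y y• = trans (•-act l (a₀ ∷ [])) (model (slot l) (slot-• l [] y•))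
    where
    l = locate y
    model : ∀ i → p• i ≡ true → p• (pα₀ i) ≡ false
    model f₀ _ = refl
    model f₃ _ = refl
    model f₄ _ = refl
    model f₉ _ = refl
    model f₁ () ; model f₂ () ; model f₅ () ; model f₆ () ; model f₇ () ; model f₈ ()

  unlabelled-far•-in-tile : ∀ y → • y ≡ false → far• y ≡ true ⊎ far• (P.α₁ y) ≡ true
  unlabelled-far•-in-tile y y∘ =
    Data.Sum.map (trans (•-act l (a₀ ∷ []))) (trans (•-act l (a₀ ∷ a₁ ∷ []))) (model (slot l) (slot-• l [] y∘))
    where
    l = locate y
    model : ∀ i → p• i ≡ false → p• (pα₀ i) ≡ true ⊎ p• (pα₀ (pα₁ i)) ≡ true
    model f₁ _ = inj₁ refl
    model f₂ _ = inj₁ refl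
    model f₅ _ = inj₁ refl
    model f₆ _ = inj₂ refl
    model f₇ _ = inj₂ refl
    model f₈ _ = inj₁ refl
    model f₀ () ; model f₃ () ; model f₄ () ; model f₉ ()

  arc-α₁-far• : ∀ y → IsArc y → far• (P.α₁ y) ≡ true
  arc-α₁-far• y (y∘ , y→∘) with unlabelled-far•-in-tile y y∘
  ... | inj₁ far• = ⊥-elim (true≢false (trans (sym far•) y→∘))
  ... | inj₂ α₁y→• = α₁y→•

  facingArc : P.Flag → P.Flag
  facingArc y = iter P.σ 2 (P.α₁ y)

  v₂-faces-arc : ∀ y → • y ≡ false → far• y ≡ true → far• (P.α₁ y) ≡ true → IsArc (facingArc y)
  v₂-faces-arc y y∘ y→• α₁y→• =
    Data.Product.map (trans (•-act l (a₁ ∷ a₀ ∷ a₁ ∷ a₀ ∷ a₁ ∷ [])))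
                     (trans (•-act l (a₀ ∷ a₁ ∷ a₀ ∷ a₁ ∷ a₀ ∷ a₁ ∷ [])))
      (model (slot l) (slot-• l [] y∘) (slot-• l (a₀ ∷ []) y→•) (slot-• l (a₀ ∷ a₁ ∷ []) α₁y→•))
    where
    l = locate y
    model : ∀ i → p• i ≡ false → p• (pα₀ i) ≡ true → p• (pα₀ (pα₁ i)) ≡ true →
            p• (pα₁ (pα₀ (pα₁ (pα₀ (pα₁ i))))) ≡ false × p• (pα₀ (pα₁ (pα₀ (pα₁ (pα₀ (pα₁ i)))))) ≡ false
    model f₁ _ _ _ = refl , refl
    model f₂ _ _ _ = refl , refl
    model f₀ () ; model f₃ () ; model f₄ () ; model f₉ ()
    model f₅ _ _ () ; model f₈ _ _ () ; model f₆ _ () ; model f₇ _ ()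

  arc-σ²α₁ : ∀ y → IsArc y → far• (iter P.σ 2 (P.α₁ y)) ≡ true × iter P.σ 3 (P.α₁ y) ≡ P.α₀ (P.σ y)
  arc-σ²α₁ y (y∘ , y→∘) =
    Data.Product.map (trans (•-act l (a₀ ∷ a₁ ∷ a₀ ∷ a₁ ∷ a₀ ∷ a₁ ∷ [])))
                     (act-≡ l (a₁ ∷ a₀ ∷ a₁ ∷ a₀ ∷ a₁ ∷ a₀ ∷ a₁ ∷ []) (a₀ ∷ a₁ ∷ a₀ ∷ []))
      (model (slot l) (slot-• l [] y∘) (slot-• l (a₀ ∷ []) y→∘))
    where
    l = locate y
    model : ∀ i → p• i ≡ false → p• (pα₀ i) ≡ false →
            p• (pα₀ (pα₁ (pα₀ (pα₁ (pα₀ (pα₁ i)))))) ≡ true ×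
            pα₁ (pα₀ (pα₁ (pα₀ (pα₁ (pα₀ (pα₁ i)))))) ≡ pα₀ (pα₁ (pα₀ i))
    model f₆ _ _ = refl , refl
    model f₇ _ _ = refl , refl
    model f₀ () ; model f₃ () ; model f₄ () ; model f₉ ()
    model f₁ _ () ; model f₂ _ () ; model f₅ _ () ; model f₈ _ ()

  arc-σ⁴α₁ : ∀ y → IsArc y → iter P.σ 4 (P.α₁ y) ≡ P.α₀ y
  arc-σ⁴α₁ y (y∘ , y→∘) = act-≡ l (a₁ ∷ a₀ ∷ a₁ ∷ a₀ ∷ a₁ ∷ a₀ ∷ a₁ ∷ a₀ ∷ a₁ ∷ []) (a₀ ∷ [])
    (model (slot l) (slot-• l [] y∘) (slot-• l (a₀ ∷ []) y→∘))
    where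
    l = locate y
    model : ∀ i → p• i ≡ false → p• (pα₀ i) ≡ false →
            pα₁ (pα₀ (pα₁ (pα₀ (pα₁ (pα₀ (pα₁ (pα₀ (pα₁ i)))))))) ≡ pα₀ i
    model f₆ _ _ = refl
    model f₇ _ _ = refl
    model f₀ () ; model f₃ () ; model f₄ () ; model f₉ ()
    model f₁ _ () ; model f₂ _ () ; model f₅ _ () ; model f₈ _ ()

  straight-α₁ : ∀ d → • d ≡ true → straight (P.α₁ d) ≡ not (straight d)
  straight-α₁ d d• =
    trans (•-act l (a₀ ∷ a₁ ∷ a₀ ∷ a₁ ∷ []))
          (trans (model (slot l) (slot-• l [] d•)) (cong not (sym (•-act l (a₀ ∷ a₁ ∷ a₀ ∷ [])))))
    where
    l = locate d
    model : ∀ i → p• i ≡ true → p• (pα₀ (pα₁ (pα₀ (pα₁ i)))) ≡ not (p• (pα₀ (pα₁ (pα₀ i))))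
    model f₀ _ = refl
    model f₃ _ = refl
    model f₄ _ = refl
    model f₉ _ = refl
    model f₁ () ; model f₂ () ; model f₅ () ; model f₆ () ; model f₇ () ; model f₈ ()

  straight-σ³ : ∀ d → • d ≡ true → straight d ≡ true →
                far• (iter P.σ 3 d) ≡ false × P.α₀ (iter P.σ 3 d) ≡ P.σ (P.α₁ d)
  straight-σ³ d d• str =
    Data.Product.map (trans (•-act l (a₀ ∷ a₁ ∷ a₀ ∷ a₁ ∷ a₀ ∷ a₁ ∷ a₀ ∷ [])))
                     (act-≡ l (a₀ ∷ a₁ ∷ a₀ ∷ a₁ ∷ a₀ ∷ a₁ ∷ a₀ ∷ []) (a₁ ∷ a₀ ∷ a₁ ∷ []))
      (model (slot l) (slot-• l [] d•) (slot-• l (a₀ ∷ a₁ ∷ a₀ ∷ []) str))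
    where
    l = locate d
    model : ∀ i → p• i ≡ true → p• (pα₀ (pα₁ (pα₀ i))) ≡ true →
            p• (pα₀ (pα₁ (pα₀ (pα₁ (pα₀ (pα₁ (pα₀ i))))))) ≡ false ×
            pα₀ (pα₁ (pα₀ (pα₁ (pα₀ (pα₁ (pα₀ i)))))) ≡ pα₁ (pα₀ (pα₁ i))
    model f₀ _ _ = refl , refl
    model f₃ _ _ = refl , refl
    model f₁ () ; model f₂ () ; model f₅ () ; model f₆ () ; model f₇ () ; model f₈ ()
    model f₄ _ () ; model f₉ _ ()

  bent-is-σ²-of-straight : ∀ d → • d ≡ true → straight d ≡ false →
    let h = P.α₀ (P.σ (P.α₁ d)) in • h ≡ true × straight h ≡ true × iter P.σ 2 h ≡ d
  bent-is-σ²-of-straight d d• bent =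
    Data.Product.map (trans (•-act l (a₀ ∷ a₁ ∷ a₀ ∷ a₁ ∷ [])))
      (Data.Product.map (trans (•-act l (a₀ ∷ a₁ ∷ a₀ ∷ a₀ ∷ a₁ ∷ a₀ ∷ a₁ ∷ [])))
                        (act-≡ l (a₁ ∷ a₀ ∷ a₁ ∷ a₀ ∷ a₀ ∷ a₁ ∷ a₀ ∷ a₁ ∷ []) []))
      (model (slot l) (slot-• l [] d•) (slot-• l (a₀ ∷ a₁ ∷ a₀ ∷ []) bent))
    where
    l = locate d
    model : ∀ i → p• i ≡ true → p• (pα₀ (pα₁ (pα₀ i))) ≡ false →
            p• (pα₀ (pα₁ (pα₀ (pα₁ i)))) ≡ true ×
            p• (pα₀ (pα₁ (pα₀ (pα₀ (pα₁ (pα₀ (pα₁ i))))))) ≡ true ×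
            pα₁ (pα₀ (pα₁ (pα₀ (pα₀ (pα₁ (pα₀ (pα₁ i))))))) ≡ i
    model f₄ _ _ = refl , refl , refl
    model f₉ _ _ = refl , refl , refl
    model f₁ () ; model f₂ () ; model f₅ () ; model f₆ () ; model f₇ () ; model f₈ ()
    model f₀ _ () ; model f₃ _ ()

  α₀-injective : Injective _≡_ _≡_ P.α₀
  α₀-injective = involutive⇒injective P.α₀ P.α₀-invol

  α₁-injective : Injective _≡_ _≡_ P.α₁
  α₁-injective = involutive⇒injective P.α₁ P.α₁-invol

  α₂-injective : Injective _≡_ _≡_ P.α₂
  α₂-injective = involutive⇒injective P.α₂ P.α₂-invol

  ρ³≡id : ∀ x → • x ≡ false → P.ρ (P.ρ (P.ρ x)) ≡ x
  ρ³≡id x x∘ = proj₁ (proj₂ (proj₁ good x x∘))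

  ρ≢id : ∀ x → • x ≡ false → P.ρ x ≢ x
  ρ≢id x x∘ = proj₂ (proj₂ (proj₁ good x x∘)) 1 (s≤s z≤n) (s≤s (s≤s z≤n))

  ρ²≢id : ∀ x → • x ≡ false → P.ρ (P.ρ x) ≢ x
  ρ²≢id x x∘ = proj₂ (proj₂ (proj₁ good x x∘)) 2 (s≤s z≤n) (s≤s (s≤s (s≤s z≤n)))

  ρ²≡ρ⁻¹ : ∀ x → • x ≡ false → P.ρ (P.ρ x) ≡ P.α₁ (P.α₂ x)
  ρ²≡ρ⁻¹ x x∘ = begin
    P.ρ (P.ρ x)                         ≡⟨ P.α₁-invol _ ⟨
    P.α₁ (P.α₁ (P.ρ (P.ρ x)))           ≡⟨ cong P.α₁ (P.α₂-invol _) ⟨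
    P.α₁ (P.α₂ (P.ρ (P.ρ (P.ρ x))))     ≡⟨ cong (P.α₁ ∘ P.α₂) (ρ³≡id x x∘) ⟩
    P.α₁ (P.α₂ x)                       ∎
    where open ≡-Reasoning

  ρ⁻²≡ρ : ∀ x → • x ≡ false → P.α₁ (P.α₂ (P.α₁ (P.α₂ x))) ≡ P.ρ x
  ρ⁻²≡ρ x x∘ = begin
    P.α₁ (P.α₂ (P.α₁ (P.α₂ x)))   ≡⟨ ρ²≡ρ⁻¹ (P.α₁ (P.α₂ x)) (trans (•-α₁ _) (trans (•-α₂ x) x∘)) ⟨
    P.ρ (P.ρ (P.α₁ (P.α₂ x)))     ≡⟨ cong P.ρ (trans (cong P.α₂ (P.α₁-invol _)) (P.α₂-invol x)) ⟩
    P.ρ x                         ∎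
    where open ≡-Reasoning

  α₂α₁-arc : ∀ z → • z ≡ false → far• (P.α₁ z) ≡ false → IsArc (P.α₂ (P.α₁ z))
  α₂α₁-arc z z∘ α₁z→∘ = trans (•-α₂ _) (trans (•-α₁ z) z∘) , trans (far•-α₂ _) α₁z→∘

  at-most-one-unlabelled-neighbour : ∀ z → • z ≡ false → far• (P.α₁ z) ≡ false → far• (P.α₁ (P.α₂ z)) ≡ true
  at-most-one-unlabelled-neighbour z z∘ α₁z→∘ = begin
    far• (P.α₁ (P.α₂ z))                   ≡⟨ cong far• (ρ²≡ρ⁻¹ z z∘) ⟨
    far• (P.α₂ (P.α₁ (P.α₂ (P.α₁ z))))     ≡⟨ far•-α₂ _ ⟩
    far• (P.α₁ (P.α₂ (P.α₁ z)))            ≡⟨ arc-α₁-far• _ (α₂α₁-arc z z∘ α₁z→∘) ⟩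
    true                                   ∎
    where open ≡-Reasoning

  acrossVertex : P.Flag → P.Flag
  acrossVertex x = P.α₂ (P.α₁ (P.α₂ x))

  acrossVertex-involutive : ∀ x → acrossVertex (acrossVertex x) ≡ x
  acrossVertex-involutive x =
    trans (cong (P.α₂ ∘ P.α₁) (P.α₂-invol _)) (trans (cong P.α₂ (P.α₁-invol _)) (P.α₂-invol x))

  facingArc-injective : Injective _≡_ _≡_ facingArc
  facingArc-injective = α₁-injective ∘ α₀-injective ∘ α₁-injective ∘ α₀-injective ∘ α₁-injective

  -- acrossVertex moves an arc flag to the third tile at its vertex, where that vertex is the
  -- corner v₂; facingArc then leads on to the arc of that tile.
  nextArc : P.Flag → P.Flag
  nextArc = facingArc ∘ acrossVertex

  nextArc-injective : Injective _≡_ _≡_ nextArc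
  nextArc-injective = involutive⇒injective acrossVertex acrossVertex-involutive ∘ facingArc-injective

  nextArc-arc : ∀ a → IsArc a → IsArc (nextArc a)
  nextArc-arc a (a∘ , a→∘) = v₂-faces-arc b b∘ b→• α₁b→•
    where
    b = acrossVertex a
    b∘ : • b ≡ false
    b∘ = trans (•-α₂ _) (trans (•-α₁ _) (trans (•-α₂ a) a∘))
    b→• : far• b ≡ true
    b→• = trans (far•-α₂ _) (arc-α₁-far• (P.α₂ a) (trans (•-α₂ a) a∘ , trans (far•-α₂ a) a→∘))
    α₁b→• : far• (P.α₁ b) ≡ true
    α₁b→• = trans (cong far• (ρ⁻²≡ρ a a∘)) (trans (far•-α₂ _) (arc-α₁-far• a (a∘ , a→∘)))

  -- nextArc permutes the finitely many arc flags, so the arc facing a corner v₂ is the image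
  -- of an arc flag, necessarily the one across the vertex.
  at-least-one-unlabelled-neighbour : ∀ z → • z ≡ false → far• z ≡ true → far• (P.α₁ z) ≡ true →
                                     far• (P.α₁ (P.α₂ z)) ≡ false
  at-least-one-unlabelled-neighbour z z∘ z→• α₁z→•
    with invariant-preimage nextArc nextArc-injective IsArc nextArc-arc _ (v₂-faces-arc z z∘ z→• α₁z→•)
  ... | b , (_ , b→∘) , nextArc-b≡facingArc-z = begin
    far• (P.α₁ (P.α₂ z))       ≡⟨ far•-α₂ _ ⟨
    far• (acrossVertex z)      ≡⟨ cong far• b≡ ⟨
    far• b                     ≡⟨ b→∘ ⟩
    false                      ∎
    where
    open ≡-Reasoning
    b≡ : b ≡ acrossVertex z
    b≡ = trans (sym (acrossVertex-involutive b)) (cong acrossVertex (facingArc-injective nextArc-b≡facingArc-z))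

  exactly-one-unlabelled-neighbour : ∀ z → • z ≡ false → far• z ≡ true → far• (P.α₁ (P.α₂ z)) ≡ not (far• (P.α₁ z))
  exactly-one-unlabelled-neighbour z z∘ z→• with far• (P.α₁ z) in α₁z→
  ... | true  = at-least-one-unlabelled-neighbour z z∘ z→• α₁z→
  ... | false = at-most-one-unlabelled-neighbour z z∘ α₁z→

  -- For z at an unlabelled vertex on an edge towards •, otherHalf z is the flag at that vertex on the
  -- other half of the same edge of the quadrilateral tiling: in the same tile, or across the arc.
  otherHalf : P.Flag → P.Flag
  otherHalf z = if far• (P.α₁ z) then P.α₁ z else P.α₁ (P.α₂ (P.α₁ z))

  otherHalf-straight : ∀ z → far• (P.α₁ z) ≡ true → otherHalf z ≡ P.α₁ z
  otherHalf-straight z α₁z→• = cong (if_then P.α₁ z else P.α₁ (P.α₂ (P.α₁ z))) α₁z→•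

  otherHalf-bent : ∀ z → far• (P.α₁ z) ≡ false → otherHalf z ≡ P.α₁ (P.α₂ (P.α₁ z))
  otherHalf-bent z α₁z→∘ = cong (if_then P.α₁ z else P.α₁ (P.α₂ (P.α₁ z))) α₁z→∘

  module _ {z : P.Flag} (z∘ : • z ≡ false) (z→• : far• z ≡ true) where

    otherHalf-far• : far• (otherHalf z) ≡ true
    otherHalf-far• with far• (P.α₁ z) in α₁z→
    ... | true  = α₁z→
    ... | false = arc-α₁-far• _ (α₂α₁-arc z z∘ α₁z→)

    far•-α₁-otherHalf : far• (P.α₁ (otherHalf z)) ≡ far• (P.α₁ z)
    far•-α₁-otherHalf with far• (P.α₁ z) in α₁z→
    ... | true  = trans (cong far• (P.α₁-invol z)) z→•
    ... | false = trans (cong far• (P.α₁-invol _)) (trans (far•-α₂ _) α₁z→)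

    otherHalf-involutive : otherHalf (otherHalf z) ≡ z
    otherHalf-involutive with far• (P.α₁ z) in α₁z→
    ... | true  = trans (otherHalf-straight _ (trans (cong far• (P.α₁-invol z)) z→•)) (P.α₁-invol z)
    ... | false = begin
      otherHalf (P.α₁ (P.α₂ (P.α₁ z)))              ≡⟨ otherHalf-bent _ α₁ᵢz→∘ ⟩
      P.α₁ (P.α₂ (P.α₁ (P.α₁ (P.α₂ (P.α₁ z)))))      ≡⟨ cong (P.α₁ ∘ P.α₂) (P.α₁-invol _) ⟩
      P.α₁ (P.α₂ (P.α₂ (P.α₁ z)))                   ≡⟨ cong P.α₁ (P.α₂-invol _) ⟩
      P.α₁ (P.α₁ z)                                 ≡⟨ P.α₁-invol z ⟩
      z                                             ∎
      where
      open ≡-Reasoning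
      α₁ᵢz→∘ : far• (P.α₁ (P.α₁ (P.α₂ (P.α₁ z)))) ≡ false
      α₁ᵢz→∘ = trans (cong far• (P.α₁-invol _)) (trans (far•-α₂ _) α₁z→)

    otherHalf≢id : otherHalf z ≢ z
    otherHalf≢id with far• (P.α₁ z) in α₁z→
    ... | true  = P.α₁-fpf z
    ... | false = λ eq → P.α₂-fpf (P.α₁ z) (α₁-injective (trans eq (sym (P.α₁-invol z))))

    otherHalf≢α₂ : otherHalf z ≢ P.α₂ z
    otherHalf≢α₂ with far• (P.α₁ z) in α₁z→
    ... | true  = λ eq → ρ≢id z z∘ (trans (cong P.α₂ eq) (P.α₂-invol z))
    ... | false = λ eq → ρ²≢id z z∘ (trans (cong P.α₂ eq) (P.α₂-invol z))

    otherHalf-α₂ : otherHalf (P.α₂ z) ≡ P.α₂ (otherHalf z)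
    otherHalf-α₂ with far• (P.α₁ z) in α₁z→
    ... | true  = begin
      otherHalf (P.α₂ z)                 ≡⟨ otherHalf-bent _ (trans (exactly-one-unlabelled-neighbour z z∘ z→•) (cong not α₁z→)) ⟩
      P.α₁ (P.α₂ (P.α₁ (P.α₂ z)))        ≡⟨ ρ⁻²≡ρ z z∘ ⟩
      P.α₂ (P.α₁ z)                      ∎
      where open ≡-Reasoning
    ... | false = begin
      otherHalf (P.α₂ z)                 ≡⟨ otherHalf-straight _ (trans (exactly-one-unlabelled-neighbour z z∘ z→•) (cong not α₁z→)) ⟩
      P.α₁ (P.α₂ z)                      ≡⟨ ρ²≡ρ⁻¹ z z∘ ⟨
      P.α₂ (P.α₁ (P.α₂ (P.α₁ z)))        ∎
      where open ≡-Reasoning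

  -- α₀ and σ of the quadrilateral tiling, on the flags at • vertices.
  qα₀ : P.Flag → P.Flag
  qα₀ d = P.α₀ (otherHalf (P.α₀ d))

  qσ : P.Flag → P.Flag
  qσ d = P.α₁ (qα₀ d)

  qσ-straight : ∀ d → straight d ≡ true → qσ d ≡ iter P.σ 2 d
  qσ-straight d str = cong (P.α₁ ∘ P.α₀) (otherHalf-straight (P.α₀ d) str)

  qσ-bent : ∀ d → straight d ≡ false → qσ d ≡ P.σ (P.α₁ (P.α₂ (P.σ d)))
  qσ-bent d bent = cong (P.α₁ ∘ P.α₀) (otherHalf-bent (P.α₀ d) bent)

  module _ {d : P.Flag} (d• : • d ≡ true) where
    private
      z = P.α₀ d
      z∘ : • z ≡ false
      z∘ = •-far-unlabelled d d•
      z→• : far• z ≡ true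
      z→• = trans (far•-α₀ d) d•

    qα₀-• : • (qα₀ d) ≡ true
    qα₀-• = otherHalf-far• z∘ z→•

    qα₀-involutive : qα₀ (qα₀ d) ≡ d
    qα₀-involutive = begin
      P.α₀ (otherHalf (P.α₀ (P.α₀ (otherHalf z))))  ≡⟨ cong (P.α₀ ∘ otherHalf) (P.α₀-invol _) ⟩
      P.α₀ (otherHalf (otherHalf z))                ≡⟨ cong P.α₀ (otherHalf-involutive z∘ z→•) ⟩
      P.α₀ z                                        ≡⟨ P.α₀-invol d ⟩
      d                                             ∎
      where open ≡-Reasoning

    qα₀≢id : qα₀ d ≢ d
    qα₀≢id eq = otherHalf≢id z∘ z→• (trans (sym (P.α₀-invol _)) (cong P.α₀ eq))

    qα₀-α₂ : qα₀ (P.α₂ d) ≡ P.α₂ (qα₀ d)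
    qα₀-α₂ = begin
      P.α₀ (otherHalf (P.α₀ (P.α₂ d)))  ≡⟨ cong (P.α₀ ∘ otherHalf) (P.α₀α₂-comm d) ⟩
      P.α₀ (otherHalf (P.α₂ z))         ≡⟨ cong P.α₀ (otherHalf-α₂ z∘ z→•) ⟩
      P.α₀ (P.α₂ (otherHalf z))         ≡⟨ P.α₀α₂-comm _ ⟩
      P.α₂ (qα₀ d)                      ∎
      where open ≡-Reasoning

    qα₀α₂≢id : qα₀ (P.α₂ d) ≢ d
    qα₀α₂≢id eq = otherHalf≢α₂ z∘ z→• (begin
      otherHalf z                  ≡⟨ P.α₀-invol _ ⟨
      P.α₀ (qα₀ d)                 ≡⟨ cong P.α₀ (α₂-injective (trans (sym qα₀-α₂) (trans eq (sym (P.α₂-invol d))))) ⟩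
      P.α₀ (P.α₂ d)                ≡⟨ P.α₀α₂-comm d ⟩
      P.α₂ z                       ∎)
      where open ≡-Reasoning

    straight-qα₀ : straight (qα₀ d) ≡ straight d
    straight-qα₀ = trans (cong (far• ∘ P.α₁) (P.α₀-invol _)) (far•-α₁-otherHalf z∘ z→•)

    straight-α₂ : straight (P.α₂ d) ≡ not (straight d)
    straight-α₂ = trans (cong (far• ∘ P.α₁) (P.α₀α₂-comm d)) (exactly-one-unlabelled-neighbour z z∘ z→•)

  -- The quadrilateral of a straight corner d is cut by an arc into the pentagon of d and the pentagon
  -- of the arc flag w; qσ alternately runs through the corner v₂ of one of them (σ²) and past an end
  -- of the arc.
  module StraightCorner {d : P.Flag} (d• : • d ≡ true) (str : straight d ≡ true) where

    qσ¹ : qσ d ≡ iter P.σ 2 d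
    qσ¹ = qσ-straight d str

    private
      z₁ = iter P.σ 3 d
      z₁→∘ : far• z₁ ≡ false
      z₁→∘ = proj₁ (straight-σ³ d d• str)
      z₁∘ : • z₁ ≡ false
      z₁∘ = trans (•-α₁ _) (•-far-unlabelled (iter P.σ 2 d)
                  (trans (cong • (sym qσ¹)) (trans (•-α₁ _) (qα₀-• d•))))
      w = P.α₂ z₁
      w-arc : IsArc w
      w-arc = trans (•-α₂ z₁) z₁∘ , trans (far•-α₂ z₁) z₁→∘
      d₂ = P.σ (P.α₁ w)
      d₃ = iter P.σ 2 d₂
      σd₃≡α₀w : P.σ d₃ ≡ P.α₀ w
      σd₃≡α₀w = arc-σ⁴α₁ w w-arc

    qσ² : qσ (qσ d) ≡ d₂
    qσ² = trans (cong qσ qσ¹) (qσ-bent _ z₁→∘)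

    qσ³ : qσ (qσ (qσ d)) ≡ d₃
    qσ³ = trans (cong qσ qσ²) (qσ-straight d₂ (proj₁ (arc-σ²α₁ w w-arc)))

    qσ⁴ : qσ (qσ (qσ (qσ d))) ≡ d
    qσ⁴ = begin
      qσ (qσ (qσ (qσ d)))               ≡⟨ cong qσ qσ³ ⟩
      qσ d₃                             ≡⟨ qσ-bent d₃ (trans (cong far• σd₃≡α₀w) (trans (far•-α₀ w) (proj₁ w-arc))) ⟩
      P.σ (P.α₁ (P.α₂ (P.σ d₃)))        ≡⟨ cong (P.σ ∘ P.α₁ ∘ P.α₂) σd₃≡α₀w ⟩
      P.σ (P.α₁ (P.α₂ (P.α₀ w)))        ≡⟨ cong (P.σ ∘ P.α₁) (trans (cong P.α₂ (P.α₀α₂-comm z₁)) (P.α₂-invol _)) ⟩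
      P.σ (P.α₁ (P.α₀ z₁))              ≡⟨ σ⁵≡id d ⟩
      d                                 ∎
      where open ≡-Reasoning

    qσ≢id : qσ d ≢ d
    qσ≢id eq = proj₂ (proj₂ (pentagonal d)) 2 (s≤s z≤n) (s≤s (s≤s (s≤s z≤n))) (trans (sym qσ¹) eq)

    qσ²≢id : qσ (qσ d) ≢ d
    qσ²≢id eq = P.α₀α₂-fpf z₁ (trans (cong P.α₀ w≡α₀z₁) (P.α₀-invol z₁))
      where
      w≡α₀z₁ : w ≡ P.α₀ z₁
      w≡α₀z₁ = begin
        w                          ≡⟨ P.α₁-invol w ⟨
        P.α₁ (P.α₁ w)              ≡⟨ cong P.α₁ (P.α₀-invol _) ⟨
        P.α₁ (P.α₀ (P.α₀ (P.α₁ w))) ≡⟨ cong (P.α₁ ∘ P.α₀) (P.α₁-invol _) ⟨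
        P.α₁ (P.α₀ (P.α₁ d₂))      ≡⟨ cong (P.α₁ ∘ P.α₀ ∘ P.α₁) (trans (sym qσ²) eq) ⟩
        P.σ (P.α₁ d)               ≡⟨ proj₂ (straight-σ³ d d• str) ⟨
        P.α₀ z₁                    ∎
        where open ≡-Reasoning

    qσ³≢id : qσ (qσ (qσ d)) ≢ d
    qσ³≢id eq = true≢false (begin
      true              ≡⟨ str ⟨
      far• (P.σ d)      ≡⟨ cong (far• ∘ P.σ) (trans (sym qσ³) eq) ⟨
      far• (P.σ d₃)     ≡⟨ cong far• σd₃≡α₀w ⟩
      far• (P.α₀ w)     ≡⟨ far•-α₀ w ⟩
      • w               ≡⟨ proj₁ w-arc ⟩
      false             ∎)
      where open ≡-Reasoning

  qα₀-midpoint : ∀ x → far• (P.α₁ x) ≡ true → qα₀ (P.α₀ x) ≡ P.α₀ (P.α₁ x)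
  qα₀-midpoint x α₁x→• = begin
    P.α₀ (otherHalf (P.α₀ (P.α₀ x)))  ≡⟨ cong (P.α₀ ∘ otherHalf) (P.α₀-invol x) ⟩
    P.α₀ (otherHalf x)                ≡⟨ cong P.α₀ (otherHalf-straight x α₁x→•) ⟩
    P.α₀ (P.α₁ x)                     ∎
    where open ≡-Reasoning

  qα₀-arc : ∀ x → IsArc x → qα₀ (P.α₀ (P.α₁ x)) ≡ P.α₀ (P.α₁ (P.α₂ x))
  qα₀-arc x (_ , x→∘) = begin
    P.α₀ (otherHalf (P.α₀ (P.α₀ (P.α₁ x)))) ≡⟨ cong (P.α₀ ∘ otherHalf) (P.α₀-invol _) ⟩
    P.α₀ (otherHalf (P.α₁ x))              ≡⟨ cong P.α₀ (otherHalf-bent _ (trans (cong far• (P.α₁-invol x)) x→∘)) ⟩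
    P.α₀ (P.α₁ (P.α₂ (P.α₁ (P.α₁ x))))     ≡⟨ cong (P.α₀ ∘ P.α₁ ∘ P.α₂) (P.α₁-invol x) ⟩
    P.α₀ (P.α₁ (P.α₂ x))                   ∎
    where open ≡-Reasoning

  arc-qσ : ∀ x → IsArc x → qσ (P.σ (P.α₁ x)) ≡ P.α₀ (P.σ x)
  arc-qσ x x-arc = trans (qσ-straight _ (proj₁ (arc-σ²α₁ x x-arc))) (proj₂ (arc-σ²α₁ x x-arc))

  qFlags : Enumeration P.size •
  qFlags = enumerate P.size •

  module QF = Enumeration qFlags

  QFlag : Set
  QFlag = Fin QF.count

  qα₀-pres : ∀ d → • d ≡ true → • (qα₀ d) ≡ true
  qα₀-pres d = qα₀-•

  α₁-pres : ∀ d → • d ≡ true → • (P.α₁ d) ≡ true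
  α₁-pres d d• = trans (•-α₁ d) d•

  α₂-pres : ∀ d → • d ≡ true → • (P.α₂ d) ≡ true
  α₂-pres d d• = trans (•-α₂ d) d•

  qα₀ᶜ qα₁ᶜ qα₂ᶜ : QFlag → QFlag
  qα₀ᶜ = QF.restrict qα₀ qα₀-pres
  qα₁ᶜ = QF.restrict P.α₁ α₁-pres
  qα₂ᶜ = QF.restrict P.α₂ α₂-pres

  element-qα₀ᶜ : ∀ i → QF.element (qα₀ᶜ i) ≡ qα₀ (QF.element i)
  element-qα₀ᶜ = QF.element-restrict qα₀ qα₀-pres

  element-qα₁ᶜ : ∀ i → QF.element (qα₁ᶜ i) ≡ P.α₁ (QF.element i)
  element-qα₁ᶜ = QF.element-restrict P.α₁ α₁-pres

  element-qα₂ᶜ : ∀ i → QF.element (qα₂ᶜ i) ≡ P.α₂ (QF.element i)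
  element-qα₂ᶜ = QF.element-restrict P.α₂ α₂-pres

  data FlagKind (x : P.Flag) : Set where
    is-corner   : • x ≡ true → FlagKind x
    is-midpoint : • x ≡ false → far• x ≡ true → FlagKind x
    is-arc      : • x ≡ false → far• x ≡ false → FlagKind x

  kind : ∀ x → FlagKind x
  kind x with • x in x• | far• x in x→
  ... | true  | _     = is-corner x•
  ... | false | true  = is-midpoint x• x→
  ... | false | false = is-arc x• x→

  nearestCorner : P.Flag → P.Flag
  nearestCorner x = if • x then x else if far• x then P.α₀ x else P.α₀ (P.α₁ x)

  nearestCorner-corner : ∀ {x} → • x ≡ true → nearestCorner x ≡ x
  nearestCorner-corner {x} x• rewrite x• = refl

  nearestCorner-midpoint : ∀ {x} → • x ≡ false → far• x ≡ true → nearestCorner x ≡ P.α₀ x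
  nearestCorner-midpoint {x} x∘ x→• rewrite x∘ | x→• = refl

  nearestCorner-arc : ∀ {x} → • x ≡ false → far• x ≡ false → nearestCorner x ≡ P.α₀ (P.α₁ x)
  nearestCorner-arc {x} x∘ x→∘ rewrite x∘ | x→∘ = refl

  nearestCorner-• : ∀ x → • (nearestCorner x) ≡ true
  nearestCorner-• x with kind x
  ... | is-corner x•      = trans (cong • (nearestCorner-corner x•)) x•
  ... | is-midpoint x∘ x→• = trans (cong • (nearestCorner-midpoint x∘ x→•)) x→•
  ... | is-arc x∘ x→∘      = trans (cong • (nearestCorner-arc x∘ x→∘)) (arc-α₁-far• x (x∘ , x→∘))

  toQ : P.Flag → QFlag
  toQ x = QF.index (nearestCorner x) (nearestCorner-• x)

  toQ-element : ∀ i → toQ (QF.element i) ≡ i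
  toQ-element i = trans (QF.index-cong (nearestCorner-corner (QF.element-valid i))) (QF.index-element i (QF.element-valid i))

  toQ-step : (f : P.Flag → P.Flag) (fᶜ : QFlag → QFlag) → (∀ i → QF.element (fᶜ i) ≡ f (QF.element i)) →
             ∀ {x y} → f (nearestCorner x) ≡ nearestCorner y → fᶜ (toQ x) ≡ toQ y
  toQ-step f fᶜ element-fᶜ {x} {y} eq = QF.element-injective (begin
    QF.element (fᶜ (toQ x))          ≡⟨ element-fᶜ (toQ x) ⟩
    f (QF.element (toQ x))           ≡⟨ cong f (QF.element-index _ _) ⟩
    f (nearestCorner x)             ≡⟨ eq ⟩
    nearestCorner y                 ≡⟨ QF.element-index _ _ ⟨
    QF.element (toQ y)               ∎)
    where open ≡-Reasoning

  QConnected : QFlag → QFlag → Set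
  QConnected = Orbit₃ qα₀ᶜ qα₁ᶜ qα₂ᶜ

  module _ {x y : P.Flag} where
    via-≡ : nearestCorner x ≡ nearestCorner y → QConnected (toQ x) (toQ y)
    via-≡ eq = subst (QConnected (toQ x)) (QF.index-cong eq) here

    via-qα₀ : qα₀ (nearestCorner x) ≡ nearestCorner y → QConnected (toQ x) (toQ y)
    via-qα₀ eq = subst (QConnected (toQ x)) (toQ-step qα₀ qα₀ᶜ element-qα₀ᶜ eq) (by-f here)

    via-α₁ : P.α₁ (nearestCorner x) ≡ nearestCorner y → QConnected (toQ x) (toQ y)
    via-α₁ eq = subst (QConnected (toQ x)) (toQ-step P.α₁ qα₁ᶜ element-qα₁ᶜ eq) (by-g here)

    via-α₂ : P.α₂ (nearestCorner x) ≡ nearestCorner y → QConnected (toQ x) (toQ y)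
    via-α₂ eq = subst (QConnected (toQ x)) (toQ-step P.α₂ qα₂ᶜ element-qα₂ᶜ eq) (by-h here)

  toQ-α₀ : ∀ x → QConnected (toQ x) (toQ (P.α₀ x))
  toQ-α₀ x with kind x
  ... | is-corner x• = via-≡ (begin
    nearestCorner x             ≡⟨ nearestCorner-corner x• ⟩
    x                           ≡⟨ P.α₀-invol x ⟨
    P.α₀ (P.α₀ x)               ≡⟨ nearestCorner-midpoint (•-far-unlabelled x x•) (trans (far•-α₀ x) x•) ⟨
    nearestCorner (P.α₀ x)      ∎)
    where open ≡-Reasoning
  ... | is-midpoint x∘ x→• =
    via-≡ (trans (nearestCorner-midpoint x∘ x→•) (sym (nearestCorner-corner x→•)))
  ... | is-arc x∘ x→∘ =
    Orbit₃-trans (via-α₁ (trans (cong P.α₁ (nearestCorner-arc x∘ x→∘)) (sym (nearestCorner-corner d•))))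
    (Orbit₃-trans (via-qα₀ (trans (cong qα₀ (nearestCorner-corner d•)) (sym (nearestCorner-corner (qα₀-• d•)))))
                  (via-α₁ (begin
      P.α₁ (nearestCorner (qα₀ d))    ≡⟨ cong P.α₁ (nearestCorner-corner (qα₀-• d•)) ⟩
      qσ d                            ≡⟨ arc-qσ x (x∘ , x→∘) ⟩
      P.α₀ (P.σ x)                    ≡⟨ nearestCorner-arc x→∘ (trans (far•-α₀ x) x∘) ⟨
      nearestCorner (P.α₀ x)          ∎)))
    where
    open ≡-Reasoning
    d = P.σ (P.α₁ x)
    d• : • d ≡ true
    d• = trans (•-α₁ _) (arc-α₁-far• x (x∘ , x→∘))

  toQ-α₁ : ∀ x → QConnected (toQ x) (toQ (P.α₁ x))
  toQ-α₁ x with kind x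
  ... | is-corner x• =
    via-α₁ (trans (cong P.α₁ (nearestCorner-corner x•)) (sym (nearestCorner-corner (trans (•-α₁ x) x•))))
  ... | is-arc x∘ x→∘ = via-≡ (begin
    nearestCorner x              ≡⟨ nearestCorner-arc x∘ x→∘ ⟩
    P.α₀ (P.α₁ x)                ≡⟨ nearestCorner-midpoint (trans (•-α₁ x) x∘) (arc-α₁-far• x (x∘ , x→∘)) ⟨
    nearestCorner (P.α₁ x)       ∎)
    where open ≡-Reasoning
  ... | is-midpoint x∘ x→• with kind (P.α₁ x)
  ...   | is-corner α₁x• = ⊥-elim (true≢false (trans (sym α₁x•) (trans (•-α₁ x) x∘)))
  ...   | is-midpoint _ α₁x→ = via-qα₀ (begin
    qα₀ (nearestCorner x)        ≡⟨ cong qα₀ (nearestCorner-midpoint x∘ x→•) ⟩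
    qα₀ (P.α₀ x)                 ≡⟨ qα₀-midpoint x α₁x→ ⟩
    P.α₀ (P.α₁ x)                ≡⟨ nearestCorner-midpoint (trans (•-α₁ x) x∘) α₁x→ ⟨
    nearestCorner (P.α₁ x)       ∎)
    where open ≡-Reasoning
  ...   | is-arc _ α₁x→ = via-≡ (begin
    nearestCorner x              ≡⟨ nearestCorner-midpoint x∘ x→• ⟩
    P.α₀ x                       ≡⟨ cong P.α₀ (P.α₁-invol x) ⟨
    P.α₀ (P.α₁ (P.α₁ x))         ≡⟨ nearestCorner-arc (trans (•-α₁ x) x∘) α₁x→ ⟨
    nearestCorner (P.α₁ x)       ∎)
    where open ≡-Reasoning

  toQ-α₂ : ∀ x → QConnected (toQ x) (toQ (P.α₂ x))
  toQ-α₂ x with kind x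
  ... | is-corner x• =
    via-α₂ (trans (cong P.α₂ (nearestCorner-corner x•)) (sym (nearestCorner-corner (trans (•-α₂ x) x•))))
  ... | is-midpoint x∘ x→• = via-α₂ (begin
    P.α₂ (nearestCorner x)       ≡⟨ cong P.α₂ (nearestCorner-midpoint x∘ x→•) ⟩
    P.α₂ (P.α₀ x)                ≡⟨ P.α₀α₂-comm x ⟨
    P.α₀ (P.α₂ x)                ≡⟨ nearestCorner-midpoint (trans (•-α₂ x) x∘) (trans (far•-α₂ x) x→•) ⟨
    nearestCorner (P.α₂ x)       ∎)
    where open ≡-Reasoning
  ... | is-arc x∘ x→∘ = via-qα₀ (begin
    qα₀ (nearestCorner x)                  ≡⟨ cong qα₀ (nearestCorner-arc x∘ x→∘) ⟩
    qα₀ (P.α₀ (P.α₁ x))                    ≡⟨ qα₀-arc x (x∘ , x→∘) ⟩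
    P.α₀ (P.α₁ (P.α₂ x))                   ≡⟨ nearestCorner-arc (trans (•-α₂ x) x∘) (trans (far•-α₂ x) x→∘) ⟨
    nearestCorner (P.α₂ x)                 ∎)
    where open ≡-Reasoning

  toQ-connected : ∀ {x y} → Orbit₃ P.α₀ P.α₁ P.α₂ x y → QConnected (toQ x) (toQ y)
  toQ-connected here     = here
  toQ-connected (by-f o) = Orbit₃-trans (toQ-connected o) (toQ-α₀ _)
  toQ-connected (by-g o) = Orbit₃-trans (toQ-connected o) (toQ-α₁ _)
  toQ-connected (by-h o) = Orbit₃-trans (toQ-connected o) (toQ-α₂ _)

  Q : GMap
  Q = record
    { size      = QF.count
    ; nonempty  = >-nonZero⁻¹ QF.count {{Fin.nonZeroIndex (toQ (Located.base (locate some-flag)))}}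
    ; α₀ = qα₀ᶜ ; α₁ = qα₁ᶜ ; α₂ = qα₂ᶜ
    ; α₀-invol  = QF.restrict-involutive qα₀-pres (λ d → qα₀-involutive)
    ; α₁-invol  = QF.restrict-involutive α₁-pres (λ d _ → P.α₁-invol d)
    ; α₂-invol  = QF.restrict-involutive α₂-pres (λ d _ → P.α₂-invol d)
    ; α₀-fpf    = QF.restrict-fpf qα₀-pres (λ d → qα₀≢id)
    ; α₁-fpf    = QF.restrict-fpf α₁-pres (λ d _ → P.α₁-fpf d)
    ; α₂-fpf    = QF.restrict-fpf α₂-pres (λ d _ → P.α₂-fpf d)
    ; α₀α₂-comm = QF.restrict-comm qα₀-pres α₂-pres (λ d → qα₀-α₂)
    ; α₀α₂-fpf  = QF.restrict-∘-fpf qα₀-pres α₂-pres (λ d → qα₀α₂≢id)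
    ; connected = λ i j → subst₂ QConnected (toQ-element i) (toQ-element j)
                            (toQ-connected (P.connected (QF.element i) (QF.element j)))
    }
    where
    some-flag : P.Flag
    some-flag = fromℕ< P.nonempty

  element-σQ : ∀ i → QF.element (σ Q i) ≡ qσ (QF.element i)
  element-σQ = QF.element-restrict₂ P.α₁ α₁-pres qα₀ qα₀-pres

  element-ρQ : ∀ i → QF.element (ρ Q i) ≡ P.ρ (QF.element i)
  element-ρQ = QF.element-restrict₂ P.α₂ α₂-pres P.α₁ α₁-pres

  σQ-injective : Injective _≡_ _≡_ (σ Q)
  σQ-injective = involutive⇒injective qα₀ᶜ (α₀-invol Q) ∘ involutive⇒injective qα₁ᶜ (α₁-invol Q)

  straight-corner-period : ∀ {d} → • d ≡ true → straight d ≡ true → Period qσ d 4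
  straight-corner-period d• str = s≤s z≤n , qσ⁴ , λ where
      0 () _
      1 _ _ → qσ≢id
      2 _ _ → qσ²≢id
      3 _ _ → qσ³≢id
      (suc (suc (suc (suc _)))) _ (s≤s (s≤s (s≤s (s≤s ()))))
    where open StraightCorner d• str

  Q-quadrilateral : IsQuadrilateral Q
  Q-quadrilateral i = by-straightness (straight (QF.element i)) refl
    where
    by-straightness : ∀ b → straight (QF.element i) ≡ b → Period (σ Q) i 4
    by-straightness true str =
      Period-reflect QF.element QF.element-injective element-σQ (straight-corner-period (QF.element-valid i) str)
    by-straightness false bent =
      subst (λ j → Period (σ Q) j 4) σQ-j≡i
        (Period-shift σQ-injective (Period-reflect QF.element QF.element-injective element-σQ
          (straight-corner-period (trans (cong • (QF.element-index h h•)) h•)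
                                  (trans (cong straight (QF.element-index h h•)) h-str))))
      where
      open ≡-Reasoning
      h = P.α₀ (P.σ (P.α₁ (QF.element i)))
      h• : • h ≡ true
      h• = proj₁ (bent-is-σ²-of-straight (QF.element i) (QF.element-valid i) bent)
      h-str : straight h ≡ true
      h-str = proj₁ (proj₂ (bent-is-σ²-of-straight (QF.element i) (QF.element-valid i) bent))
      j = QF.index h h•
      σQ-j≡i : σ Q j ≡ i
      σQ-j≡i = QF.element-injective (begin
        QF.element (σ Q j)      ≡⟨ element-σQ j ⟩
        qσ (QF.element j)       ≡⟨ cong qσ (QF.element-index h h•) ⟩
        qσ h                   ≡⟨ StraightCorner.qσ¹ h• h-str ⟩
        iter P.σ 2 h           ≡⟨ proj₂ (proj₂ (bent-is-σ²-of-straight (QF.element i) (QF.element-valid i) bent)) ⟩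
        QF.element i            ∎)

  Q-tiling : IsTiling P → IsTiling Q
  Q-tiling (P-degrees , _) =
    (λ i n period → P-degrees (QF.element i) n (Period-map QF.element QF.element-injective element-ρQ period)) ,
    (λ i n period → subst (3 ≤_) (Period-unique (Q-quadrilateral i) period) (s≤s (s≤s (s≤s z≤n))))

  Q-choice : Choice Q
  Q-choice = record
    { chosen    = λ i → not (straight (QF.element i))
    ; chosen-α₀ = λ i → cong not (trans (cong straight (element-qα₀ᶜ i)) (straight-qα₀ (QF.element-valid i)))
    ; chosen-α₁ = λ i → cong not (trans (cong straight (element-qα₁ᶜ i)) (straight-α₁ _ (QF.element-valid i)))
    ; chosen-α₂ = λ i → cong not (trans (cong straight (element-qα₂ᶜ i)) (straight-α₂ (QF.element-valid i)))
    }

  open Subdivision Q Q-choice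
  open SubdivisionSteps Q Q-choice

  arcIndex : ∀ x → IsArc x → QFlag
  arcIndex x x-arc = QF.index (P.α₀ (P.α₁ x)) (arc-α₁-far• x x-arc)

  arcIndex-chosen : ∀ x (x-arc : IsArc x) → T (chosen Q-choice (arcIndex x x-arc))
  arcIndex-chosen x x-arc@(_ , x→∘) = Equivalence.from T-≡ (cong not (begin
    straight (QF.element (arcIndex x x-arc)) ≡⟨ cong straight (QF.element-index _ (arc-α₁-far• x x-arc)) ⟩
    far• (P.α₁ (P.α₀ (P.α₀ (P.α₁ x))))      ≡⟨ cong (far• ∘ P.α₁) (P.α₀-invol _) ⟩
    far• (P.α₁ (P.α₁ x))                    ≡⟨ cong far• (P.α₁-invol x) ⟩
    far• x                                  ≡⟨ x→∘ ⟩
    false                                   ∎))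
    where open ≡-Reasoning

  toSFlagOfKind : ∀ x → FlagKind x → SFlag
  toSFlagOfKind x (is-corner x•)      = corner (QF.index x x•)
  toSFlagOfKind x (is-midpoint _ x→•) = mid (QF.index (P.α₀ x) x→•)
  toSFlagOfKind x (is-arc x∘ x→∘)     = arc (arcIndex x (x∘ , x→∘)) (arcIndex-chosen x (x∘ , x→∘))

  toSFlagOfKind-irrelevant : ∀ x (k k′ : FlagKind x) → toSFlagOfKind x k ≡ toSFlagOfKind x k′
  toSFlagOfKind-irrelevant x (is-corner _)     (is-corner _)     = refl
  toSFlagOfKind-irrelevant x (is-midpoint _ _) (is-midpoint _ _) = refl
  toSFlagOfKind-irrelevant x (is-arc _ _)      (is-arc _ _)      = arc-cong refl
  toSFlagOfKind-irrelevant x (is-corner x•)    (is-midpoint x∘ _) = ⊥-elim (true≢false (trans (sym x•) x∘))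
  toSFlagOfKind-irrelevant x (is-corner x•)    (is-arc x∘ _)      = ⊥-elim (true≢false (trans (sym x•) x∘))
  toSFlagOfKind-irrelevant x (is-midpoint x∘ _) (is-corner x•)    = ⊥-elim (true≢false (trans (sym x•) x∘))
  toSFlagOfKind-irrelevant x (is-arc x∘ _)     (is-corner x•)     = ⊥-elim (true≢false (trans (sym x•) x∘))
  toSFlagOfKind-irrelevant x (is-midpoint _ x→•) (is-arc _ x→∘)   = ⊥-elim (true≢false (trans (sym x→•) x→∘))
  toSFlagOfKind-irrelevant x (is-arc _ x→∘)    (is-midpoint _ x→•) = ⊥-elim (true≢false (trans (sym x→•) x→∘))

  toSFlag : P.Flag → SFlag
  toSFlag x = toSFlagOfKind x (kind x)

  toSFlag-kind : ∀ {x} (k : FlagKind x) → toSFlag x ≡ toSFlagOfKind x k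
  toSFlag-kind k = toSFlagOfKind-irrelevant _ (kind _) k

  module _ (f : P.Flag → P.Flag) (sf : SFlag → SFlag) {x : P.Flag} (k : FlagKind x) (k′ : FlagKind (f x)) where
    toSFlag-homo-at : toSFlagOfKind (f x) k′ ≡ sf (toSFlagOfKind x k) → toSFlag (f x) ≡ sf (toSFlag x)
    toSFlag-homo-at eq = trans (toSFlag-kind k′) (trans eq (cong sf (sym (toSFlag-kind k))))

  chosen-midpoint : ∀ x (x→• : far• x ≡ true) → chosen Q-choice (QF.index (P.α₀ x) x→•) ≡ not (far• (P.α₁ x))
  chosen-midpoint x x→• = cong not (trans (cong straight (QF.element-index _ x→•)) (cong (far• ∘ P.α₁) (P.α₀-invol x)))

  toSFlag-α₀ : ∀ x → toSFlag (P.α₀ x) ≡ sα₀ (toSFlag x)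
  toSFlag-α₀ x = by-kind (kind x)
    where
    by-kind : FlagKind x → toSFlag (P.α₀ x) ≡ sα₀ (toSFlag x)
    by-kind k@(is-corner x•) = toSFlag-homo-at P.α₀ sα₀ k
      (is-midpoint (•-far-unlabelled x x•) (trans (far•-α₀ x) x•)) (cong mid (QF.index-cong (P.α₀-invol x)))
    by-kind k@(is-midpoint x∘ x→•) = toSFlag-homo-at P.α₀ sα₀ k (is-corner x→•) refl
    by-kind k@(is-arc x∘ x→∘) = toSFlag-homo-at P.α₀ sα₀ k (is-arc x→∘ (trans (far•-α₀ x) x∘))
      (arc-cong (QF.element-injective (begin
        QF.element (arcIndex (P.α₀ x) α₀x-arc)    ≡⟨ QF.element-index _ (arc-α₁-far• _ α₀x-arc) ⟩
        P.α₀ (P.σ x)                             ≡⟨ arc-qσ x x-arc ⟨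
        qσ (P.σ (P.α₁ x))                        ≡⟨ cong (qσ ∘ P.α₁) (QF.element-index _ (arc-α₁-far• x x-arc)) ⟨
        qσ (P.α₁ (QF.element (arcIndex x x-arc))) ≡⟨ cong qσ (element-qα₁ᶜ _) ⟨
        qσ (QF.element (qα₁ᶜ (arcIndex x x-arc))) ≡⟨ element-σQ _ ⟨
        QF.element (σ Q (qα₁ᶜ (arcIndex x x-arc))) ∎)))
      where
      open ≡-Reasoning
      x-arc : IsArc x
      x-arc = x∘ , x→∘
      α₀x-arc : IsArc (P.α₀ x)
      α₀x-arc = x→∘ , trans (far•-α₀ x) x∘

  toSFlag-α₁ : ∀ x → toSFlag (P.α₁ x) ≡ sα₁ (toSFlag x)
  toSFlag-α₁ x = by-kind (kind x)
    where
    by-kind : FlagKind x → toSFlag (P.α₁ x) ≡ sα₁ (toSFlag x)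
    by-kind k@(is-corner x•) = toSFlag-homo-at P.α₁ sα₁ k
      (is-corner (trans (•-α₁ x) x•)) (cong corner (sym (QF.restrict-index P.α₁ α₁-pres x•)))
    by-kind k@(is-arc x∘ x→∘) = toSFlag-homo-at P.α₁ sα₁ k
      (is-midpoint (trans (•-α₁ x) x∘) (arc-α₁-far• x (x∘ , x→∘))) refl
    by-kind k@(is-midpoint x∘ x→•) = by-kind′ (kind (P.α₁ x))
      where
      by-kind′ : FlagKind (P.α₁ x) → toSFlag (P.α₁ x) ≡ sα₁ (toSFlag x)
      by-kind′ (is-corner α₁x•) = ⊥-elim (true≢false (trans (sym α₁x•) (trans (•-α₁ x) x∘)))
      by-kind′ k′@(is-midpoint _ α₁x→•) = toSFlag-homo-at P.α₁ sα₁ k k′ (begin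
        mid (QF.index (P.α₀ (P.α₁ x)) α₁x→•)   ≡⟨ cong mid (QF.index-cong (qα₀-midpoint x α₁x→•)) ⟨
        mid (QF.index (qα₀ (P.α₀ x)) (qα₀-pres _ x→•)) ≡⟨ cong mid (QF.restrict-index qα₀ qα₀-pres x→•) ⟨
        mid (qα₀ᶜ (QF.index (P.α₀ x) x→•))     ≡⟨ sα₁-mid-unchosen (trans (chosen-midpoint x x→•) (cong not α₁x→•)) ⟨
        sα₁ (mid (QF.index (P.α₀ x) x→•))      ∎)
        where open ≡-Reasoning
      by-kind′ k′@(is-arc _ α₁x→∘) = toSFlag-homo-at P.α₁ sα₁ k k′
        (trans (arc-cong (QF.index-cong (cong P.α₀ (P.α₁-invol x))))
               (sym (sα₁-mid-chosen (Equivalence.from T-≡ (trans (chosen-midpoint x x→•) (cong not α₁x→∘))))))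

  toSFlag-α₂ : ∀ x → toSFlag (P.α₂ x) ≡ sα₂ (toSFlag x)
  toSFlag-α₂ x = by-kind (kind x)
    where
    by-kind : FlagKind x → toSFlag (P.α₂ x) ≡ sα₂ (toSFlag x)
    by-kind k@(is-corner x•) = toSFlag-homo-at P.α₂ sα₂ k
      (is-corner (trans (•-α₂ x) x•)) (cong corner (sym (QF.restrict-index P.α₂ α₂-pres x•)))
    by-kind k@(is-midpoint x∘ x→•) = toSFlag-homo-at P.α₂ sα₂ k
      (is-midpoint (trans (•-α₂ x) x∘) (trans (far•-α₂ x) x→•))
      (cong mid (trans (QF.index-cong (P.α₀α₂-comm x)) (sym (QF.restrict-index P.α₂ α₂-pres x→•))))
    by-kind k@(is-arc x∘ x→∘) = toSFlag-homo-at P.α₂ sα₂ k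
      (is-arc (trans (•-α₂ x) x∘) (trans (far•-α₂ x) x→∘))
      (arc-cong (trans (QF.index-cong (sym (qα₀-arc x (x∘ , x→∘)))) (sym (QF.restrict-index qα₀ qα₀-pres (arc-α₁-far• x (x∘ , x→∘))))))

  toSFlag-injective : Injective _≡_ _≡_ toSFlag
  toSFlag-injective {x} {y} eq = by-kinds (kind x) (kind y) (trans (sym (toSFlag-kind _)) (trans eq (toSFlag-kind _)))
    where
    by-kinds : (k : FlagKind x) (k′ : FlagKind y) → toSFlagOfKind x k ≡ toSFlagOfKind y k′ → x ≡ y
    by-kinds (is-corner _)     (is-corner _)     eq = QF.index-injective (cong sflagIndex eq)
    by-kinds (is-midpoint _ _) (is-midpoint _ _) eq = α₀-injective (QF.index-injective (cong sflagIndex eq))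
    by-kinds (is-arc _ _)      (is-arc _ _)      eq =
      α₁-injective (α₀-injective (QF.index-injective (cong sflagIndex eq)))
    by-kinds (is-corner _)     (is-midpoint _ _) ()
    by-kinds (is-corner _)     (is-arc _ _)      ()
    by-kinds (is-midpoint _ _) (is-corner _)     ()
    by-kinds (is-midpoint _ _) (is-arc _ _)      ()
    by-kinds (is-arc _ _)      (is-corner _)     ()
    by-kinds (is-arc _ _)      (is-midpoint _ _) ()

  toSFlag-surjective : Surjective _≡_ _≡_ toSFlag
  toSFlag-surjective (corner i) = QF.element i , λ { refl →
    trans (toSFlag-kind (is-corner (QF.element-valid i))) (cong corner (QF.index-element i _)) }
  toSFlag-surjective (mid i) = P.α₀ d , λ { refl →
    trans (toSFlag-kind (is-midpoint (•-far-unlabelled d d•) (trans (far•-α₀ d) d•)))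
          (cong mid (trans (QF.index-cong (P.α₀-invol d)) (QF.index-element i d•))) }
    where
    d = QF.element i
    d• : • d ≡ true
    d• = QF.element-valid i
  toSFlag-surjective (arc i p) = P.α₁ (P.α₀ d) , λ { refl →
    trans (toSFlag-kind (is-arc (trans (•-α₁ _) (•-far-unlabelled d d•)) (Equivalence.to T-not-≡ p)))
          (arc-cong (trans (QF.index-cong (trans (cong P.α₀ (P.α₁-invol _)) (P.α₀-invol d))) (QF.index-element i d•))) }
    where
    d = QF.element i
    d• : • d ≡ true
    d• = QF.element-valid i

  Q-subdivision : IsoToSubdivision P Q Q-choice
  Q-subdivision = record
    { to        = toSFlag
    ; bijective = toSFlag-injective , toSFlag-surjective
    ; to-α₀     = toSFlag-α₀
    ; to-α₁     = toSFlag-α₁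
    ; to-α₂     = toSFlag-α₂
    }

  isSimplePentagonalSubdivision : IsTiling P → IsSimplePentagonalSubdivision P
  isSimplePentagonalSubdivision tiling = Q , Q-tiling tiling , Q-quadrilateral , Q-choice , Q-subdivision

-- From a simple pentagonal subdivision to a good labelling

module FromSubdivision (P Q : GMap) (Q-tiling : IsTiling Q) (Q-quadrilateral : IsQuadrilateral Q)
                       (C : Choice Q) (iso : IsoToSubdivision P Q C) where
  module P = GMap P
  module Q = GMap Q
  open Subdivision Q C
  open SubdivisionSteps Q C
  open IsoToSubdivision iso
  open GMapOrbits Q using (sameVertex?; sameEdge?; sameVertex⇒ρ-orbit; sameEdge⇒edgeFlag; edgeFlag⇒sameEdge;
                           sameVertex-sym; sameEdge-sym)

  to-injective : Injective _≡_ _≡_ to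
  to-injective = proj₁ bijective

  from : SFlag → P.Flag
  from s = proj₁ (proj₂ bijective s)

  to-from : ∀ s → to (from s) ≡ s
  to-from s = proj₂ (proj₂ bijective s) refl

  from-to : ∀ x → from (to x) ≡ x
  from-to x = to-injective (to-from (to x))

  from-homo : (f : P.Flag → P.Flag) (F : SFlag → SFlag) → (∀ x → to (f x) ≡ F (to x)) →
              ∀ s → from (F s) ≡ f (from s)
  from-homo f F to-f s = to-injective (begin
    to (from (F s))     ≡⟨ to-from (F s) ⟩
    F s                 ≡⟨ cong F (to-from s) ⟨
    F (to (from s))     ≡⟨ to-f (from s) ⟨
    to (f (from s))     ∎)
    where open ≡-Reasoning

  Orbit₂-from : ∀ {f g : P.Flag → P.Flag} {F G : SFlag → SFlag} →
                (∀ x → to (f x) ≡ F (to x)) → (∀ x → to (g x) ≡ G (to x)) →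
                ∀ {y t} → Orbit₂ F G (to y) t → Orbit₂ f g y (from t)
  Orbit₂-from {f} {g} {F} {G} to-f to-g {y} o =
    subst (λ u → Orbit₂ f g u _) (from-to y) (Orbit₂-map from (from-homo f F to-f) (from-homo g G to-g) o)

  isCorner : SFlag → Bool
  isCorner (corner _) = true
  isCorner (mid _)    = false
  isCorner (arc _ _)  = false

  isCorner-sα₁ : ∀ s → isCorner (sα₁ s) ≡ isCorner s
  isCorner-sα₁ (corner _) = refl
  isCorner-sα₁ (mid d)    = isCorner-sα₁-mid (chosen C d) refl
    where
    isCorner-sα₁-mid : ∀ b (eq : chosen C d ≡ b) → isCorner (sα₁-mid d b eq) ≡ false
    isCorner-sα₁-mid true  _ = refl
    isCorner-sα₁-mid false _ = refl
  isCorner-sα₁ (arc _ _)  = refl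

  isCorner-sα₂ : ∀ s → isCorner (sα₂ s) ≡ isCorner s
  isCorner-sα₂ (corner _) = refl
  isCorner-sα₂ (mid _)    = refl
  isCorner-sα₂ (arc _ _)  = refl

  corners : Labelling P
  corners = record
    { lab    = isCorner ∘ to
    ; lab-α₁ = λ x → trans (cong isCorner (to-α₁ x)) (isCorner-sα₁ (to x))
    ; lab-α₂ = λ x → trans (cong isCorner (to-α₂ x)) (isCorner-sα₂ (to x))
    }

  sρ : SFlag → SFlag
  sρ = sα₂ ∘ sα₁

  to-ρ : ∀ x → to (P.ρ x) ≡ sρ (to x)
  to-ρ x = trans (to-α₂ _) (cong sα₂ (to-α₁ x))

  chosen-α₂α₀ : ∀ d → chosen C (Q.α₂ (Q.α₀ d)) ≡ not (chosen C d)
  chosen-α₂α₀ d = trans (chosen-α₂ C _) (cong not (chosen-α₀ C d))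

  α₂α₀α₂α₀≡id : ∀ d → Q.α₂ (Q.α₀ (Q.α₂ (Q.α₀ d))) ≡ d
  α₂α₀α₂α₀≡id d = trans (cong Q.α₂ (Q.α₀α₂-comm _)) (trans (Q.α₂-invol _) (Q.α₀-invol d))

  midpoint-cycle : ∀ d (unchosen : chosen C d ≡ false) →
    ThreeCycle sρ (mid d) (mid (Q.α₂ (Q.α₀ d)))
                  (arc (Q.α₀ (Q.α₂ (Q.α₀ d))) (Equivalence.from T-≡ (trans (chosen-α₀ C _) (trans (chosen-α₂α₀ d) (cong not unchosen)))))
  midpoint-cycle d unchosen = record
    { fa≡b = cong sα₂ (sα₁-mid-unchosen unchosen)
    ; fb≡c = trans (cong sα₂ (sα₁-mid-chosen (Equivalence.from T-≡ (trans (chosen-α₂α₀ d) (cong not unchosen)))))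
                   (arc-cong refl)
    ; fc≡a = cong mid (α₂α₀α₂α₀≡id d)
    ; a≢b  = λ eq → Q.α₀α₂-fpf d (trans (cong (Q.α₀ ∘ Q.α₂) (cong sflagIndex eq))
                                        (trans (cong Q.α₀ (Q.α₂-invol _)) (Q.α₀-invol d)))
    ; b≢c  = λ ()
    ; c≢a  = λ ()
    }

  sρ-period-3 : ∀ s → isCorner s ≡ false → Period sρ s 3
  sρ-period-3 (mid d) _ = by-choice (chosen C d) refl
    where
    by-choice : ∀ b → chosen C d ≡ b → Period sρ (mid d) 3
    by-choice false unchosen = ThreeCycle⇒Period (midpoint-cycle d unchosen)
    by-choice true  chosen-d = subst (λ e → Period sρ (mid e) 3) α₂α₀d′≡d
      (ThreeCycle⇒Period (ThreeCycle-rotate (midpoint-cycle d′ d′-unchosen)))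
      where
      d′ = Q.α₀ (Q.α₂ d)
      d′-unchosen : chosen C d′ ≡ false
      d′-unchosen = trans (chosen-α₀ C _) (trans (chosen-α₂ C d) (cong not chosen-d))
      α₂α₀d′≡d : Q.α₂ (Q.α₀ d′) ≡ d
      α₂α₀d′≡d = trans (cong Q.α₂ (Q.α₀-invol _)) (Q.α₂-invol d)
  sρ-period-3 (arc d p) _ = subst (λ s → Period sρ s 3) (arc-cong (α₀α₂α₀d′≡d))
    (ThreeCycle⇒Period (ThreeCycle-rotate (ThreeCycle-rotate (midpoint-cycle d′ d′-unchosen))))
    where
    d′ = Q.α₀ (Q.α₂ (Q.α₀ d))
    d′-unchosen : chosen C d′ ≡ false
    d′-unchosen = trans (chosen-α₀ C _) (trans (chosen-α₂α₀ d) (cong not (Equivalence.to T-≡ p)))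
    α₀α₂α₀d′≡d : Q.α₀ (Q.α₂ (Q.α₀ d′)) ≡ d
    α₀α₂α₀d′≡d = trans (cong (Q.α₀ ∘ Q.α₂) (Q.α₀-invol _)) (trans (cong Q.α₀ (Q.α₂-invol _)) (Q.α₀-invol d))

  unlabelled-degree-3 : ∀ x → lab corners x ≡ false → Period P.ρ x 3
  unlabelled-degree-3 x x∘ = Period-reflect to to-injective to-ρ (sρ-period-3 (to x) x∘)

  AtVertex : Q.Flag → SFlag → Set
  AtVertex h (corner d) = SameVertex Q h d
  AtVertex h (mid _)    = ⊥
  AtVertex h (arc _ _)  = ⊥

  OnEdge : Q.Flag → SFlag → Set
  OnEdge h (corner _) = ⊥
  OnEdge h (mid d)    = SameEdge Q h d
  OnEdge h (arc d _)  = SameEdge Q h d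

  SameHalfEdge : Q.Flag → Q.Flag → Set
  SameHalfEdge h d = h ≡ d ⊎ Q.α₂ h ≡ d

  OnHalfEdge : Q.Flag → SFlag → Set
  OnHalfEdge h (corner d) = SameHalfEdge h d
  OnHalfEdge h (mid d)    = SameHalfEdge h d
  OnHalfEdge h (arc _ _)  = ⊥

  OnArc : SFlag → Set
  OnArc (corner _) = ⊥
  OnArc (mid _)    = ⊥
  OnArc (arc _ _)  = ⊤

  AtVertex-sα₁ : ∀ h s → AtVertex h s → AtVertex h (sα₁ s)
  AtVertex-sα₁ h (corner d) o = by-f o

  AtVertex-sα₂ : ∀ h s → AtVertex h s → AtVertex h (sα₂ s)
  AtVertex-sα₂ h (corner d) o = by-g o

  OnEdge-sα₁ : ∀ h s → OnEdge h s → OnEdge h (sα₁ s)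
  OnEdge-sα₁ h (mid d) o   = OnEdge-sα₁-mid (chosen C d) refl
    where
    OnEdge-sα₁-mid : ∀ b (eq : chosen C d ≡ b) → OnEdge h (sα₁-mid d b eq)
    OnEdge-sα₁-mid true  _ = o
    OnEdge-sα₁-mid false _ = by-f o
  OnEdge-sα₁ h (arc d p) o = o

  OnEdge-sα₂ : ∀ h s → OnEdge h s → OnEdge h (sα₂ s)
  OnEdge-sα₂ h (mid d) o   = by-g o
  OnEdge-sα₂ h (arc d p) o = by-f o

  SameHalfEdge-α₂ : ∀ {h d} → SameHalfEdge h d → SameHalfEdge h (Q.α₂ d)
  SameHalfEdge-α₂ (inj₁ refl) = inj₂ refl
  SameHalfEdge-α₂ (inj₂ refl) = inj₁ (sym (Q.α₂-invol _))

  OnHalfEdge-sα₀ : ∀ h s → OnHalfEdge h s → OnHalfEdge h (sα₀ s)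
  OnHalfEdge-sα₀ h (corner d) o = o
  OnHalfEdge-sα₀ h (mid d)    o = o

  OnHalfEdge-sα₂ : ∀ h s → OnHalfEdge h s → OnHalfEdge h (sα₂ s)
  OnHalfEdge-sα₂ h (corner d) o = SameHalfEdge-α₂ o
  OnHalfEdge-sα₂ h (mid d)    o = SameHalfEdge-α₂ o

  OnArc-sα₀ : ∀ s → OnArc s → OnArc (sα₀ s)
  OnArc-sα₀ (arc _ _) _ = tt

  OnArc-sα₂ : ∀ s → OnArc s → OnArc (sα₂ s)
  OnArc-sα₂ (arc _ _) _ = tt

  module _ {y z : P.Flag} {s t : SFlag} (y↦s : to y ≡ s) (z↦t : to z ≡ t) where
    private
      separate : ∀ {F G : SFlag → SFlag} {f g : P.Flag → P.Flag} →
                 (∀ x → to (f x) ≡ F (to x)) → (∀ x → to (g x) ≡ G (to x)) →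
                 (I : SFlag → Set) → (∀ s → I s → I (F s)) → (∀ s → I s → I (G s)) →
                 I s → ¬ I t → ¬ Orbit₂ f g y z
      separate to-f to-g I F-pres G-pres Is ¬It o =
        Orbit₂-separates I F-pres G-pres (subst I (sym y↦s) Is) (¬It ∘ subst I z↦t) (Orbit₂-map to to-f to-g o)

    ≉ᵥ-by-vertex : ∀ h → AtVertex h s → ¬ AtVertex h t → ¬ SameVertex P y z
    ≉ᵥ-by-vertex h = separate to-α₁ to-α₂ (AtVertex h) (AtVertex-sα₁ h) (AtVertex-sα₂ h)

    ≉ᵥ-by-edge : ∀ h → OnEdge h s → ¬ OnEdge h t → ¬ SameVertex P y z
    ≉ᵥ-by-edge h = separate to-α₁ to-α₂ (OnEdge h) (OnEdge-sα₁ h) (OnEdge-sα₂ h)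

    ≉ₑ-by-half-edge : ∀ h → OnHalfEdge h s → ¬ OnHalfEdge h t → ¬ SameEdge P y z
    ≉ₑ-by-half-edge h = separate to-α₀ to-α₂ (OnHalfEdge h) (OnHalfEdge-sα₀ h) (OnHalfEdge-sα₂ h)

    ≉ₑ-by-arc : OnArc s → ¬ OnArc t → ¬ SameEdge P y z
    ≉ₑ-by-arc = separate to-α₀ to-α₂ OnArc OnArc-sα₀ OnArc-sα₂

  σQ≢id : ∀ h → Q.σ h ≢ h
  σQ≢id h = proj₂ (proj₂ (Q-quadrilateral h)) 1 (s≤s z≤n) (s≤s (s≤s z≤n))

  σQ²≢id : ∀ h → Q.σ (Q.σ h) ≢ h
  σQ²≢id h = proj₂ (proj₂ (Q-quadrilateral h)) 2 (s≤s z≤n) (s≤s (s≤s (s≤s z≤n)))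

  ρQ≢id : ∀ h → Q.ρ h ≢ h
  ρQ≢id h ρh≡h with proj₁ Q-tiling h 1 (s≤s z≤n , ρh≡h , λ { zero () _ ; (suc _) _ (s≤s ()) })
  ... | s≤s ()

  chosen-ρᵏ : ∀ k h → chosen C (iter Q.ρ k h) ≡ chosen C h
  chosen-ρᵏ zero    h = refl
  chosen-ρᵏ (suc k) h =
    trans (chosen-α₂ C _) (trans (cong not (chosen-α₁ C _)) (trans (not-involutive _) (chosen-ρᵏ k h)))

  chosen-≢ : ∀ {h h′} → chosen C h ≡ false → chosen C h′ ≡ true → h ≢ h′
  chosen-≢ h∘ h′• refl = true≢false (trans (sym h′•) h∘)

  to-σ : ∀ x → to (P.σ x) ≡ sα₁ (sα₀ (to x))
  to-σ x = trans (to-α₁ _) (cong sα₁ (to-α₀ x))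

  -- g is the flag of a quadrilateral ABCD of Q at A on its unchosen side AB; the pentagon at corner g
  -- has the corners A, the midpoint of AB, B, and the midpoints of BC and DA.
  module Pentagon (g : Q.Flag) (g-unchosen : chosen C g ≡ false) where
    gBA = Q.α₀ g
    gBC = Q.α₁ gBA
    gAD = Q.α₁ g

    gBC-chosen : chosen C gBC ≡ true
    gBC-chosen = trans (chosen-α₁ C gBA) (cong not (trans (chosen-α₀ C g) g-unchosen))

    gAD-chosen : chosen C gAD ≡ true
    gAD-chosen = trans (chosen-α₁ C g) (cong not g-unchosen)

    x = from (corner g)
    open TileTypes P corners x

    c₁↦ : to c₁ ≡ corner g
    c₁↦ = to-from _

    c₂↦ : to c₂ ≡ mid gBA
    c₂↦ = trans (to-σ x) (trans (cong (sα₁ ∘ sα₀) c₁↦) (sα₁-mid-unchosen g-unchosen))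

    c₃↦ : to c₃ ≡ corner gBC
    c₃↦ = trans (to-σ _) (cong (sα₁ ∘ sα₀) c₂↦)

    c₄↦ : to c₄ ≡ arc gBC (Equivalence.from T-≡ gBC-chosen)
    c₄↦ = trans (to-σ _) (trans (cong (sα₁ ∘ sα₀) c₃↦) (sα₁-mid-chosen _))

    c₅↦ : to c₅ ≡ mid gAD
    c₅↦ = trans (to-σ _) (trans (cong (sα₁ ∘ sα₀) c₄↦)
                (cong (mid ∘ Q.α₁) (trans (cong Q.α₀ (Q.α₁-invol gBA)) (Q.α₀-invol g))))

    labels : Labels
    labels = cong isCorner c₁↦ , cong isCorner c₃↦ , cong isCorner c₂↦ , cong isCorner c₄↦ , cong isCorner c₅↦

    α₀α₂gBA≡α₂g : Q.α₀ (Q.α₂ gBA) ≡ Q.α₂ g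
    α₀α₂gBA≡α₂g = trans (Q.α₀α₂-comm gBA) (cong Q.α₂ (Q.α₀-invol g))

    gAD≢gBA : gAD ≢ gBA
    gAD≢gBA eq = σQ≢id gBA (trans (cong Q.α₁ (Q.α₀-invol g)) eq)

    gBC≢gAD : gBC ≢ gAD
    gBC≢gAD eq = Q.α₀-fpf g (involutive⇒injective Q.α₁ Q.α₁-invol eq)

    α₂gBC-unchosen : chosen C (Q.α₂ gBC) ≡ false
    α₂gBC-unchosen = trans (chosen-α₂ C gBC) (cong not gBC-chosen)

    α₂gBC≢gAD : Q.α₂ gBC ≢ gAD
    α₂gBC≢gAD = chosen-≢ α₂gBC-unchosen gAD-chosen

    ¬g-gBA : ¬ SameHalfEdge g gBA
    ¬g-gBA (inj₁ eq) = Q.α₀-fpf g (sym eq)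
    ¬g-gBA (inj₂ eq) = Q.α₀α₂-fpf g (trans (cong Q.α₀ eq) (Q.α₀-invol g))

    ¬g-gAD : ¬ SameHalfEdge g gAD
    ¬g-gAD (inj₁ eq) = Q.α₁-fpf g (sym eq)
    ¬g-gAD (inj₂ eq) = ρQ≢id g (trans (cong Q.α₂ (sym eq)) (Q.α₂-invol g))

    ¬gBA-gBC : ¬ SameHalfEdge gBA gBC
    ¬gBA-gBC (inj₁ eq) = Q.α₁-fpf gBA (sym eq)
    ¬gBA-gBC (inj₂ eq) = ρQ≢id gBA (trans (cong Q.α₂ (sym eq)) (Q.α₂-invol gBA))

    ¬gBC-gAD : ¬ SameHalfEdge gBC gAD
    ¬gBC-gAD (inj₁ eq) = gBC≢gAD eq
    ¬gBC-gAD (inj₂ eq) = α₂gBC≢gAD eq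

    ¬gBC~gAD : ¬ SameEdge Q gBC gAD
    ¬gBC~gAD o with sameEdge⇒edgeFlag o
    ... | inj₁ eq                = gBC≢gAD eq
    ... | inj₂ (inj₁ eq)         = σQ²≢id g (trans (cong Q.α₁ eq) (Q.α₁-invol g))
    ... | inj₂ (inj₂ (inj₁ eq))  = α₂gBC≢gAD eq
    ... | inj₂ (inj₂ (inj₂ eq))  = chosen-≢ (trans (chosen-α₀ C _) α₂gBC-unchosen) gAD-chosen eq

    gBA~gAD⇒gAD≡α₂gBA : SameEdge Q gBA gAD → gAD ≡ Q.α₂ gBA
    gBA~gAD⇒gAD≡α₂gBA o with sameEdge⇒edgeFlag o
    ... | inj₁ eq               = ⊥-elim (gAD≢gBA (sym eq))
    ... | inj₂ (inj₁ eq)        = ⊥-elim (Q.α₁-fpf g (sym (trans (sym (Q.α₀-invol g)) eq)))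
    ... | inj₂ (inj₂ (inj₁ eq)) = sym eq
    ... | inj₂ (inj₂ (inj₂ eq)) =
      ⊥-elim (ρQ≢id g (trans (cong Q.α₂ (sym (trans (sym α₀α₂gBA≡α₂g) eq))) (Q.α₂-invol g)))

    module _ (g≁gBA : ¬ SameVertex Q g gBA) where

      ¬gBA~gBC : ¬ SameEdge Q gBA gBC
      ¬gBA~gBC o with sameEdge⇒edgeFlag o
      ... | inj₁ eq               = Q.α₁-fpf gBA (sym eq)
      ... | inj₂ (inj₁ eq)        = σQ≢id g (sym (trans (sym (Q.α₀-invol g)) eq))
      ... | inj₂ (inj₂ (inj₁ eq)) = ρQ≢id gBA (trans (cong Q.α₂ (sym eq)) (Q.α₂-invol gBA))
      ... | inj₂ (inj₂ (inj₂ eq)) = g≁gBA (subst (SameVertex Q g) (Q.α₁-invol gBA)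
                                      (by-f (subst (SameVertex Q g) (trans (sym α₀α₂gBA≡α₂g) eq) (by-g here))))

      ¬gBA~gAD : ¬ SameEdge Q gBA gAD
      ¬gBA~gAD gBA~gAD = g≁gBA (sameVertex-sym (subst (SameVertex Q gBA) (Q.α₁-invol g)
        (by-f (subst (SameVertex Q gBA) (sym (gBA~gAD⇒gAD≡α₂gBA gBA~gAD)) (by-g here)))))

      type-P₁ : P₁
      type-P₁ =
        labels ,
        ≉ᵥ-by-vertex c₁↦ c₂↦ g here (λ ()) ,
        ≉ᵥ-by-vertex c₁↦ c₃↦ g here (λ g~gBC → g≁gBA (Orbit₂-trans g~gBC (sameVertex-sym (by-f here)))) ,
        ≉ᵥ-by-vertex c₁↦ c₄↦ g here (λ ()) ,
        ≉ᵥ-by-vertex c₁↦ c₅↦ g here (λ ()) ,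
        ≉ᵥ-by-edge c₂↦ c₃↦ gBA here (λ ()) ,
        ≉ᵥ-by-edge c₂↦ c₄↦ gBA here ¬gBA~gBC ,
        ≉ᵥ-by-edge c₂↦ c₅↦ gBA here ¬gBA~gAD ,
        ≉ᵥ-by-vertex c₃↦ c₄↦ gBC here (λ ()) ,
        ≉ᵥ-by-vertex c₃↦ c₅↦ gBC here (λ ()) ,
        ≉ᵥ-by-edge c₄↦ c₅↦ gBC here ¬gBC~gAD

    α₂g≡gBC⇒gBA~gBC : Q.α₂ g ≡ gBC → SameEdge Q gBA gBC
    α₂g≡gBC⇒gBA~gBC eq = edgeFlag⇒sameEdge (inj₂ (inj₂ (inj₂ (trans α₀α₂gBA≡α₂g eq))))

    module _ (g~gBA : SameVertex Q g gBA) where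

      g~gBC : SameVertex Q g gBC
      g~gBC = Orbit₂-trans g~gBA (by-f here)

      c₁~c₃ : SameVertex P c₁ c₃
      c₁~c₃ = subst (SameVertex P c₁) (trans (cong from (sym c₃↦)) (from-to c₃))
        (Orbit₂-from to-α₁ to-α₂ (subst (λ s → Orbit₂ sα₁ sα₂ s (corner gBC)) (sym c₁↦)
          (Orbit₂-map corner (λ _ → refl) (λ _ → refl) g~gBC)))

      -- ρ preserves the choice bit, which differs at g and gBC, so gBC is reached from α₁ g.
      möbius : ∃ λ k → iter P.ρ k (P.α₁ c₁) ≡ c₃
      möbius with sameVertex⇒ρ-orbit g~gBC
      ... | inj₁ (k , ρᵏg≡gBC) = ⊥-elim (chosen-≢ (trans (chosen-ρᵏ k g) g-unchosen) gBC-chosen ρᵏg≡gBC)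
      ... | inj₂ (k , ρᵏα₁g≡gBC) = k , to-injective (begin
        to (iter P.ρ k (P.α₁ c₁))        ≡⟨ iter-homo P.ρ sρ to to-ρ k _ ⟩
        iter sρ k (to (P.α₁ c₁))         ≡⟨ cong (iter sρ k) (trans (to-α₁ c₁) (cong sα₁ c₁↦)) ⟩
        iter sρ k (corner (Q.α₁ g))      ≡⟨ iter-homo Q.ρ sρ corner (λ _ → refl) k _ ⟨
        corner (iter Q.ρ k (Q.α₁ g))     ≡⟨ cong corner ρᵏα₁g≡gBC ⟩
        corner gBC                       ≡⟨ c₃↦ ⟨
        to c₃                            ∎)
        where open ≡-Reasoning

      type-P₂ : ¬ SameEdge Q gBA gBC → ¬ SameEdge Q gBA gAD → P₂
      type-P₂ ¬gBA~gBC ¬gBA~gAD =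
        labels , c₁~c₃ ,
        ≉ᵥ-by-vertex c₁↦ c₂↦ g here (λ ()) ,
        ≉ᵥ-by-vertex c₁↦ c₄↦ g here (λ ()) ,
        ≉ᵥ-by-vertex c₁↦ c₅↦ g here (λ ()) ,
        ≉ᵥ-by-edge c₂↦ c₄↦ gBA here ¬gBA~gBC ,
        ≉ᵥ-by-edge c₂↦ c₅↦ gBA here ¬gBA~gAD ,
        ≉ᵥ-by-edge c₄↦ c₅↦ gBC here ¬gBC~gAD ,
        ≉ₑ-by-half-edge c₁↦ c₂↦ g (inj₁ refl) ¬g-gBA ,
        ≉ₑ-by-half-edge c₁↦ c₃↦ g (inj₁ refl)
          (λ { (inj₁ eq) → σQ≢id g (sym eq) ; (inj₂ eq) → ¬gBA~gBC (α₂g≡gBC⇒gBA~gBC eq) }) ,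
        ≉ₑ-by-half-edge c₁↦ c₄↦ g (inj₁ refl) (λ ()) ,
        ≉ₑ-by-half-edge c₁↦ c₅↦ g (inj₁ refl) ¬g-gAD ,
        ≉ₑ-by-half-edge c₂↦ c₃↦ gBA (inj₁ refl) ¬gBA-gBC ,
        ≉ₑ-by-half-edge c₂↦ c₄↦ gBA (inj₁ refl) (λ ()) ,
        ≉ₑ-by-half-edge c₂↦ c₅↦ gBA (inj₁ refl)
          (λ { (inj₁ eq) → gAD≢gBA (sym eq) ; (inj₂ eq) → ¬gBA~gAD (edgeFlag⇒sameEdge (inj₂ (inj₂ (inj₁ eq)))) }) ,
        ≉ₑ-by-half-edge c₃↦ c₄↦ gBC (inj₁ refl) (λ ()) ,
        ≉ₑ-by-half-edge c₃↦ c₅↦ gBC (inj₁ refl) ¬gBC-gAD ,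
        ≉ₑ-by-arc c₄↦ c₅↦ tt (λ ()) ,
        möbius

      type-P₃ : SameEdge Q gBA gAD → P₃
      type-P₃ gBA~gAD =
        labels ,
        to-injective (trans c₅↦ (trans (cong mid (gBA~gAD⇒gAD≡α₂gBA gBA~gAD)) (sym (trans (to-α₂ c₂) (cong sα₂ c₂↦))))) ,
        ≉ᵥ-by-vertex c₁↦ c₂↦ g here (λ ()) ,
        ≉ᵥ-by-vertex c₁↦ c₄↦ g here (λ ()) ,
        ≉ᵥ-by-edge c₂↦ c₄↦ gBA here (λ gBA~gBC → ¬gBC~gAD (Orbit₂-trans (sameEdge-sym gBA~gBC) gBA~gAD)) ,
        ≉ₑ-by-half-edge c₁↦ c₂↦ g (inj₁ refl) ¬g-gBA ,
        ≉ₑ-by-half-edge c₁↦ c₃↦ g (inj₁ refl)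
          (λ { (inj₁ eq) → σQ≢id g (sym eq)
             ; (inj₂ eq) → ¬gBC~gAD (Orbit₂-trans (sameEdge-sym (α₂g≡gBC⇒gBA~gBC eq)) gBA~gAD) }) ,
        ≉ₑ-by-half-edge c₁↦ c₄↦ g (inj₁ refl) (λ ()) ,
        ≉ₑ-by-half-edge c₂↦ c₃↦ gBA (inj₁ refl) ¬gBA-gBC ,
        ≉ₑ-by-half-edge c₂↦ c₄↦ gBA (inj₁ refl) (λ ()) ,
        ≉ₑ-by-half-edge c₃↦ c₄↦ gBC (inj₁ refl) (λ ())

  TileType : P.Flag → Set
  TileType x = TileTypes.P₁ P corners x ⊎ TileTypes.P₂ P corners x ⊎ TileTypes.P₃ P corners x

  -- When the sides AB and BC of Q coincide, the pentagon is of type P₃ when read from B.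
  pentagon-type : ∀ g (g-unchosen : chosen C g ≡ false) →
                  TileType (Pentagon.x g g-unchosen) ⊎ TileType (Pentagon.x (Q.α₀ g) (trans (chosen-α₀ C g) g-unchosen))
  pentagon-type g g-unchosen = classify (sameVertex? g gBA) (sameEdge? gBA gAD) (sameEdge? gBA gBC)
    where
    open Pentagon g g-unchosen
    gBA-unchosen : chosen C gBA ≡ false
    gBA-unchosen = trans (chosen-α₀ C g) g-unchosen
    classify : Dec (SameVertex Q g gBA) → Dec (SameEdge Q gBA gAD) → Dec (SameEdge Q gBA gBC) →
               TileType x ⊎ TileType (Pentagon.x gBA gBA-unchosen)
    classify (no g≁gBA)  _                 _                = inj₁ (inj₁ (type-P₁ g≁gBA))
    classify (yes g~gBA) (yes gBA~gAD)     _                = inj₁ (inj₂ (inj₂ (type-P₃ g~gBA gBA~gAD)))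
    classify (yes g~gBA) (no ¬gBA~gAD)     (no ¬gBA~gBC)    = inj₁ (inj₂ (inj₁ (type-P₂ g~gBA ¬gBA~gBC ¬gBA~gAD)))
    classify (yes g~gBA) (no _)            (yes gBA~gBC)    =
      inj₂ (inj₂ (inj₂ (Pentagon.type-P₃ gBA gBA-unchosen gBA~α₀gBA α₀gBA~gBC)))
      where
      gBA~α₀gBA : SameVertex Q gBA (Q.α₀ gBA)
      gBA~α₀gBA = subst (SameVertex Q gBA) (sym (Q.α₀-invol g)) (sameVertex-sym g~gBA)
      α₀gBA~gBC : SameEdge Q (Q.α₀ gBA) gBC
      α₀gBA~gBC = Orbit₂-trans (subst (SameEdge Q (Q.α₀ gBA)) (Q.α₀-invol gBA) (by-f here)) gBA~gBC

  unchosenCornerInTile : ∀ s → ∃ λ g → chosen C g ≡ false × Orbit₂ sα₀ sα₁ s (corner g)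
  unchosenCornerInTile (corner d) = by-choice (chosen C d) refl
    where
    by-choice : ∀ b → chosen C d ≡ b → ∃ λ g → chosen C g ≡ false × Orbit₂ sα₀ sα₁ (corner d) (corner g)
    by-choice false unchosen = d , unchosen , here
    by-choice true  chosen-d = Q.α₁ d , trans (chosen-α₁ C d) (cong not chosen-d) , by-g here
  unchosenCornerInTile (mid d) =
    let g , g-unchosen , o = unchosenCornerInTile (corner d) in g , g-unchosen , Orbit₂-trans (by-f here) o
  unchosenCornerInTile (arc d p) =
    let g , g-unchosen , o = unchosenCornerInTile (corner d) in g , g-unchosen , Orbit₂-trans (by-f (by-g here)) o

  corners-good : GoodLabelling P corners
  corners-good = unlabelled-degree-3 , tile
    where
    tile : ∀ y → Σ P.Flag λ x → SameTile P y x × TileType x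
    tile y with unchosenCornerInTile (to y)
    ... | g , g-unchosen , y~g with pentagon-type g g-unchosen
    ...   | inj₁ type = _ , Orbit₂-from to-α₀ to-α₁ y~g , type
    ...   | inj₂ type = _ , Orbit₂-from to-α₀ to-α₁ (Orbit₂-trans y~g g~gBA) , type
      where
      g~gBA : Orbit₂ sα₀ sα₁ (corner g) (corner (Q.α₀ g))
      g~gBA = by-f (subst (Orbit₂ sα₀ sα₁ (corner g)) (sα₁-mid-unchosen g-unchosen) (by-g (by-f here)))

  goodLabelling : Σ (Labelling P) (GoodLabelling P)
  goodLabelling = corners , corners-good

theorem3p2 : (P : GMap) → IsTiling P → IsPentagonal P →
    (IsSimplePentagonalSubdivision P → Σ (Labelling P) (GoodLabelling P)) ×
    (Σ (Labelling P) (GoodLabelling P) → IsSimplePentagonalSubdivision P)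
theorem3p2 P tiling pentagonal =
  (λ (Q , Q-tiling , Q-quadrilateral , C , iso) → FromSubdivision.goodLabelling P Q Q-tiling Q-quadrilateral C iso) ,
  (λ (L , good) → FromLabelling.isSimplePentagonalSubdivision P pentagonal L good tiling)
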